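{- Let $q$ be a prime power with $q\equiv 1\pmod 3$, and let $C_A(q)$ be the contraction graph of $AGL(1,q)$ with respect to a distinguished element $F\in GF(q)$. Then: (a) $C_A(q)$ has exactly $q-1$ isolated vertices, and a vertex $\pi$ is isolated if and only if $\pi(F)=F$; (b) if $q$ is odd, every connected component of $C_A(q)$ that is not an isolated vertex is a cycle of length $6$; (c) if $q$ is even, every connected component of $C_A(q)$ that is not an isolated vertex is a cycle of length $3$.
   Context: $AGL(1,q)$ is the group of maps $x\mapsto ax+b$ on $GF(q)$ with $a\neq 0$. For permutations $\pi,\sigma$, $hd(\pi,\sigma)=|\{x:\pi(x)\neq\sigma(x)\}|$. Fix $F\in GF(q)$. For a permutation $\pi$ of $GF(q)$, $\pi^{\triangle}$ is the permutation with $\pi^{\triangle}(\pi^{ -1}(F))=\pi(F)$, $\pi^{\triangle}(F)=F$, and $\pi^{\triangle}(x)=\pi(x)$ otherwise. The contraction graph $C_A(q)$ has vertex set $AGL(1,q)$, and distinct $\pi,\sigma$ are adjacent iff $hd(\pi^{\triangle},\sigma^{\triangle})=q-4$. -}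

module Defs where

open import Level using (0ℓ)
open import Data.Nat using (ℕ; zero; suc; _^_; _≥_; _∸_; _%_)
open import Data.Nat.Primality using (Prime)
open import Data.Fin using (Fin; toℕ)
open import Data.Fin.Properties using (_≟_)
open import Data.Product using (Σ; ∃; _×_; _,_; proj₁; proj₂)
open import Data.Sum using (_⊎_)
open import Data.List using (List; length; filter; allFin)
open import Relation.Nullary using (¬_; Dec; yes; no; ¬?)
open import Relation.Binary.PropositionalEquality using (_≡_; _≢_)
open import Relation.Binary.Construct.Closure.ReflexiveTransitive using (Star)
open import Algebra.Structures using (IsCommutativeRing)

IsPrimePower : ℕ → Set
IsPrimePower q = Σ ℕ λ p → Σ ℕ λ k → Prime p × k ≥ 1 × q ≡ p ^ k

-- A finite field with exactly q elements, presented on the canonical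
-- carrier Fin q (every field of order q is isomorphic to such a one,
-- and GF(q) is unique up to isomorphism).
record FiniteField (q : ℕ) : Set where
  infixl 6 _+F_
  infixl 7 _*F_
  field
    _+F_ _*F_ : Fin q → Fin q → Fin q
    -F_ : Fin q → Fin q
    0F 1F : Fin q
    isCommutativeRing : IsCommutativeRing _≡_ _+F_ _*F_ -F_ 0F 1F
    0≢1 : 0F ≢ 1F
    inverse : ∀ x → x ≢ 0F → Σ (Fin q) λ y → x *F y ≡ 1F

module AGL {q : ℕ} (𝔽 : FiniteField q) (F : Fin q) where
  open FiniteField 𝔽

  Elt : Set
  Elt = Fin q × Fin q

  IsAGL : Elt → Set
  IsAGL u = proj₁ u ≢ 0F

  apply : Elt → Fin q → Fin q
  apply (a , b) x = a *F x +F b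

  contract : (Fin q → Fin q) → Fin q → Fin q
  contract π x with x ≟ F
  ... | yes _ = F
  ... | no _ with π x ≟ F
  ...   | yes _ = π F
  ...   | no _ = π x

  hd : (Fin q → Fin q) → (Fin q → Fin q) → ℕ
  hd π σ = length (filter (λ x → ¬? (π x ≟ σ x)) (allFin q))

  Adj : Elt → Elt → Set
  Adj u v = IsAGL u × IsAGL v × u ≢ v
          × hd (contract (apply u)) (contract (apply v)) ≡ q ∸ 4

  Isolated : Elt → Set
  Isolated u = ∀ v → ¬ Adj u v

  Reachable : Elt → Elt → Set
  Reachable = Star Adj

  CycAdj : (n : ℕ) → Fin (suc n) → Fin (suc n) → Set
  CycAdj n i j = toℕ j ≡ suc (toℕ i) % suc n ⊎ toℕ i ≡ suc (toℕ j) % suc n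

  ComponentIsCycle : (n : ℕ) → Elt → Set
  ComponentIsCycle n u =
    Σ (Fin (suc n) → Elt) λ v →
      (∀ i → IsAGL (v i))
    × (∀ i j → v i ≡ v j → i ≡ j)
    × (∀ w → IsAGL w → (Reachable u w → ∃ λ i → w ≡ v i)
                      × ((∃ λ i → w ≡ v i) → Reachable u w))
    × (∀ i j → (Adj (v i) (v j) → CycAdj n i j) × (CycAdj n i j → Adj (v i) (v j)))

{-# OPTIONS --safe #-}
module Submission where

-- Write an affine map as x ↦ a (x − F) + F + t. Its contraction can agree with the contraction of
-- another affine map only at F, at the two preimages of F and where the two maps cross, so adjacency
-- means agreement at all four points. Solving these equations shows that the neighbours of (a , t)
-- are the maps (w a , (1 + w) t) with w² + w + 1 = 0 and w ≠ 1. Such a root ω exists: x ↦ 1/(1 − x)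
-- has order 3 on the q − 2 ≡ 2 (mod 3) elements other than 0 and 1, so it has fixed points, and these
-- are the roots of x² − x + 1. Hence the maps with t = 0, i.e. those fixing F, are isolated, and the
-- component of any other map is its orbit under (a , t) ↦ (ω a , (1 + ω) t). The length of that
-- orbit is the common order of ω and 1 + ω = −ω²: 6 if −1 ≠ 1, and 3 in characteristic 2.

open import Defs
open import Level using (0ℓ)
open import Data.Nat as ℕ using (ℕ; zero; suc; _+_; _*_; _∸_; _≤_; _<_; z≤n; s≤s; _%_; _/_)
import Data.Nat.Properties as ℕ
open import Data.Nat.DivMod using ([m+kn]%n≡m%n; m≡m%n+[m/n]*n; m%n<n)
open import Data.Integer as ℤ using (ℤ; +_; -[1+_]; _⊖_; sign; ∣_∣; _◃_)
import Data.Integer.Properties as ℤ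
open import Data.Sign as Sign using (Sign)
open import Data.Fin using (Fin; toℕ; fromℕ<)
open import Data.Fin.Properties using (_≟_; any?; toℕ-injective; toℕ<n; toℕ-fromℕ<)
open import Data.Maybe using (Maybe; just; nothing)
open import Data.Product using (Σ; ∃; _×_; _,_; proj₁; proj₂)
open import Data.Sum as Sum using (_⊎_; inj₁; inj₂; [_,_]′)
open import Data.Empty using (⊥-elim)
open import Function using (id; _∘_; _⇔_; mk⇔; Equivalence)
open import Data.List using (List; []; _∷_; length; map; filter; allFin)
open import Data.List.Properties using (filter-accept; filter-reject; filter-none; filter-≐; filter-all; length-tabulate; length-map)
open import Data.List.Relation.Unary.All as All using (All; []; _∷_)
open import Data.List.Relation.Unary.AllPairs using ([]; _∷_)
open import Data.List.Relation.Unary.Any using (here; there)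
open import Data.List.Membership.Propositional using (_∈_; _∉_)
open import Data.List.Membership.Propositional.Properties using (∈-allFin; ∈-filter⁺; ∈-filter⁻; ∈-map⁺; ∈-map⁻)
open import Data.List.Relation.Unary.Unique.Propositional using (Unique)
import Data.List.Relation.Unary.Unique.Propositional.Properties as Unique
open import Relation.Binary.Construct.Closure.ReflexiveTransitive using (ε; _◅_; _◅◅_)
open import Relation.Nullary using (¬_; Dec; yes; no)
open import Relation.Nullary.Decidable using (decidable-stable)
open import Relation.Unary using (Pred; Decidable; _⊆_; _≐_; ∁; U)
open import Relation.Unary.Properties using (_∩?_; ∁?; U?)
open import Relation.Binary.PropositionalEquality
open import Algebra.Bundles using (CommutativeRing)
import Algebra.Properties.AbelianGroup as AbelianGroupProperties
import Algebra.Properties.CommutativeSemigroup as CommutativeSemigroupProperties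
open import Algebra.Properties.CommutativeSemigroup ℕ.+-commutativeSemigroup using (x∙yz≈y∙xz)
import Algebra.Properties.Ring as RingProperties
import Algebra.Properties.Semiring.Exp as SemiringExp
import Algebra.Properties.Semiring.Mult.TCOptimised as SemiringMult
open import Algebra.Solver.Ring.AlmostCommutativeRing using (fromCommutativeRing; _-Raw-AlmostCommutative⟶_)
import Algebra.Solver.Ring as RingSolver

module _ {A : Set} where

  length-filter-split : {P Q : Pred A 0ℓ} (P? : Decidable P) (Q? : Decidable Q) (xs : List A) →
    length (filter P? xs) ≡ length (filter (P? ∩? Q?) xs) + length (filter (P? ∩? ∁? Q?) xs)
  length-filter-split P? Q? [] = refl
  length-filter-split P? Q? (x ∷ xs) with P? x | Q? x
  ... | yes _ | yes _ = cong suc (length-filter-split P? Q? xs)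
  ... | yes _ | no _ = trans (cong suc (length-filter-split P? Q? xs)) (sym (ℕ.+-suc _ _))
  ... | no _ | yes _ = length-filter-split P? Q? xs
  ... | no _ | no _ = length-filter-split P? Q? xs

module _ {n : ℕ} where

  count : {P : Pred (Fin n) 0ℓ} → Decidable P → ℕ
  count P? = length (filter P? (allFin n))

  count-cong : {P Q : Pred (Fin n) 0ℓ} (P? : Decidable P) (Q? : Decidable Q) → P ≐ Q → count P? ≡ count Q?
  count-cong P? Q? P≐Q = cong length (filter-≐ P? Q? P≐Q (allFin n))

  count-split : {P Q : Pred (Fin n) 0ℓ} (P? : Decidable P) (Q? : Decidable Q) →
    count P? ≡ count (P? ∩? Q?) + count (P? ∩? ∁? Q?)
  count-split P? Q? = length-filter-split P? Q? (allFin n)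

  count-all : {P : Pred (Fin n) 0ℓ} (P? : Decidable P) → (∀ x → P x) → count P? ≡ n
  count-all P? all = trans (cong length (filter-all P? (All.universal all (allFin n)))) (length-tabulate _)

  count-none : {P : Pred (Fin n) 0ℓ} (P? : Decidable P) → (∀ x → ¬ P x) → count P? ≡ 0
  count-none P? none = cong length (filter-none P? (All.universal none (allFin n)))

  count-complement : {P : Pred (Fin n) 0ℓ} (P? : Decidable P) → count P? + count (∁? P?) ≡ n
  count-complement {P} P? = begin
    count P? + count (∁? P?)                ≡⟨ cong₂ _+_ (count-cong P? (U? ∩? P?) (U∩≐ P))
                                                           (count-cong (∁? P?) (U? ∩? ∁? P?) (U∩≐ (∁ P))) ⟩
    count (U? ∩? P?) + count (U? ∩? ∁? P?)  ≡⟨ count-split U? P? ⟨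
    count U?                                ≡⟨ count-all U? _ ⟩
    n                                       ∎
    where
      open ≡-Reasoning
      U∩≐ : (Q : Pred (Fin n) 0ℓ) → Q ≐ (λ x → U x × Q x)
      U∩≐ Q = (_ ,_) , proj₂

  private
    length-filter-≟-unique : (x : Fin n) (xs : List (Fin n)) → Unique xs → x ∈ xs →
      length (filter (_≟ x) xs) ≡ 1
    length-filter-≟-unique x (y ∷ xs) (y∉xs ∷ _) (here refl) =
      trans (cong length (filter-accept (_≟ x) refl))
            (cong suc (cong length (filter-none (_≟ x) (All.map (λ y≢z z≡y → y≢z (sym z≡y)) y∉xs))))
    length-filter-≟-unique x (y ∷ xs) (y∉xs ∷ u) (there x∈xs) =
      trans (cong length (filter-reject (_≟ x) {y} {xs} λ { refl → All.lookup y∉xs x∈xs refl }))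
            (length-filter-≟-unique x xs u x∈xs)

  count-singleton : (x : Fin n) → count (_≟ x) ≡ 1
  count-singleton x = length-filter-≟-unique x (allFin n) (Unique.allFin⁺ n) (∈-allFin x)

  count-remove : {P : Pred (Fin n) 0ℓ} (P? : Decidable P) {x : Fin n} → P x →
    count P? ≡ suc (count (P? ∩? ∁? (_≟ x)))
  count-remove P? {x} px = trans (count-split P? (_≟ x))
    (cong (_+ count (P? ∩? ∁? (_≟ x)))
      (trans (count-cong (P? ∩? (_≟ x)) (_≟ x) (proj₂ , λ { refl → px , refl })) (count-singleton x)))

  count-remove-∉ : {P : Pred (Fin n) 0ℓ} (P? : Decidable P) {x : Fin n} → ¬ P x →
    count P? ≡ count (P? ∩? ∁? (_≟ x))
  count-remove-∉ P? ¬px = count-cong P? (P? ∩? ∁? (_≟ _)) ((λ py → py , λ { refl → ¬px py }) , proj₁)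

  count-≤-remove : {P : Pred (Fin n) 0ℓ} (P? : Decidable P) (x : Fin n) →
    count P? ≤ suc (count (P? ∩? ∁? (_≟ x)))
  count-≤-remove P? x with P? x
  ... | yes px = ℕ.≤-reflexive (count-remove P? px)
  ... | no ¬px = ℕ.m≤n⇒m≤1+n (ℕ.≤-reflexive (count-remove-∉ P? ¬px))

  count-witness : {P : Pred (Fin n) 0ℓ} (P? : Decidable P) → 0 < count P? → ∃ P
  count-witness P? pos with filter P? (allFin n) in eq
  ... | [] = ⊥-elim (ℕ.<-irrefl refl pos)
  ... | x ∷ _ = x , proj₂ (∈-filter⁻ P? {xs = allFin n} (subst (x ∈_) (sym eq) (here refl)))

  private
    ∈-tail : ∀ {x y : Fin n} {xs} → y ∈ x ∷ xs → ¬ y ≡ x → y ∈ xs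
    ∈-tail (here y≡x) y≢x = ⊥-elim (y≢x y≡x)
    ∈-tail (there y∈xs) _ = y∈xs

  count≤length-cover : {P : Pred (Fin n) 0ℓ} (P? : Decidable P) (xs : List (Fin n)) →
    P ⊆ (_∈ xs) → count P? ≤ length xs
  count≤length-cover P? [] P⊆xs = ℕ.≤-reflexive (count-none P? (λ _ px → ∉[] (P⊆xs px)))
    where
      ∉[] : ∀ {y : Fin n} → y ∉ []
      ∉[] ()
  count≤length-cover P? (x ∷ xs) P⊆xs = ℕ.≤-trans (count-≤-remove P? x)
    (s≤s (count≤length-cover (P? ∩? ∁? (_≟ x)) xs (λ (py , y≢x) → ∈-tail (P⊆xs py) y≢x)))

  count≡length-cover⇒ : {P : Pred (Fin n) 0ℓ} (P? : Decidable P) (xs : List (Fin n)) →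
    P ⊆ (_∈ xs) → count P? ≡ length xs → All P xs × Unique xs
  count≡length-cover⇒ P? [] _ _ = [] , []
  count≡length-cover⇒ P? (x ∷ xs) P⊆xs e with P? x
  ... | no ¬px = ⊥-elim (ℕ.<-irrefl refl (ℕ.≤-trans (ℕ.≤-reflexive (sym e))
          (ℕ.≤-trans (ℕ.≤-reflexive (count-remove-∉ P? ¬px))
            (count≤length-cover (P? ∩? ∁? (_≟ x)) xs (λ (py , y≢x) → ∈-tail (P⊆xs py) y≢x)))))
  ... | yes px with count≡length-cover⇒ (P? ∩? ∁? (_≟ x)) xs (λ (py , y≢x) → ∈-tail (P⊆xs py) y≢x)
                       (ℕ.suc-injective (trans (sym (count-remove P? px)) e))
  ...   | all , unique = px ∷ All.map proj₁ all , All.map (λ (_ , y≢x) x≡y → y≢x (sym x≡y)) all ∷ unique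

  count≡length-cover⇐ : {P : Pred (Fin n) 0ℓ} (P? : Decidable P) (xs : List (Fin n)) →
    P ⊆ (_∈ xs) → All P xs → Unique xs → count P? ≡ length xs
  count≡length-cover⇐ P? [] P⊆xs [] [] = ℕ.≤-antisym (count≤length-cover P? [] P⊆xs) z≤n
  count≡length-cover⇐ P? (x ∷ xs) P⊆xs (px ∷ all) (x∉xs ∷ unique) = trans (count-remove P? px)
    (cong suc (count≡length-cover⇐ (P? ∩? ∁? (_≟ x)) xs (λ (py , y≢x) → ∈-tail (P⊆xs py) y≢x)
       (All.zipWith (λ (py , x≢y) → py , λ y≡x → x≢y (sym y≡x)) (all , x∉xs)) unique))

  Fixed? : (σ : Fin n → Fin n) → Decidable (λ x → σ x ≡ x)
  Fixed? σ x = σ x ≟ x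

  private
    module ThreeCycle {P : Pred (Fin n) 0ℓ} (P? : Decidable P) (σ : Fin n → Fin n)
                      (closed : ∀ {x} → P x → P (σ x)) (cube≡id : ∀ {x} → P x → σ (σ (σ x)) ≡ x)
                      {x : Fin n} (px : P x) (σx≢x : ¬ σ x ≡ x) where

      Q₃ : Pred (Fin n) 0ℓ
      Q₃ y = ((P y × ¬ y ≡ x) × ¬ y ≡ σ x) × ¬ y ≡ σ (σ x)

      Q₃? : Decidable Q₃
      Q₃? = ((P? ∩? ∁? (_≟ x)) ∩? ∁? (_≟ σ x)) ∩? ∁? (_≟ σ (σ x))

      private
        preimage : ∀ {y z} → P y → σ y ≡ z → y ≡ σ (σ z)
        preimage py σy≡z = trans (sym (cube≡id py)) (cong (λ w → σ (σ w)) σy≡z)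
        σ²x≢x : ¬ σ (σ x) ≡ x
        σ²x≢x e = σx≢x (sym (trans (sym (cube≡id px)) (cong σ e)))
        σ²x≢σx : ¬ σ (σ x) ≡ σ x
        σ²x≢σx e = σ²x≢x (sym (trans (sym (cube≡id px)) (cong σ e)))

      Q₃-closed : ∀ {y} → Q₃ y → Q₃ (σ y)
      Q₃-closed (((py , y≢x) , y≢σx) , y≢σ²x) =
        ((closed py , (λ e → y≢σ²x (preimage py e))) , (λ e → y≢x (trans (preimage py e) (cube≡id px)))) ,
        (λ e → y≢σx (trans (preimage py e) (cong σ (cube≡id px))))

      count-Q₃ : count P? ≡ 3 + count Q₃?
      count-Q₃ = trans (count-remove P? px) (cong suc (trans (count-remove (P? ∩? ∁? (_≟ x)) (closed px , σx≢x))
        (cong suc (count-remove ((P? ∩? ∁? (_≟ x)) ∩? ∁? (_≟ σ x)) ((closed (closed px) , σ²x≢x) , σ²x≢σx)))))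

      count-fixed-Q₃ : count (P? ∩? Fixed? σ) ≡ count (Q₃? ∩? Fixed? σ)
      count-fixed-Q₃ = count-cong _ _
        ((λ (py , f) → (((py , λ { refl → σx≢x f }) , λ { refl → σ²x≢σx f }) ,
                        λ { refl → σ²x≢x (sym (trans (sym (cube≡id px)) f)) }) , f) ,
         λ ((((py , _) , _) , _) , f) → py , f)

    module TwoCycle {P : Pred (Fin n) 0ℓ} (P? : Decidable P) (σ : Fin n → Fin n)
                    (closed : ∀ {x} → P x → P (σ x)) (square≡id : ∀ {x} → P x → σ (σ x) ≡ x)
                    {x : Fin n} (px : P x) (σx≢x : ¬ σ x ≡ x) where

      Q₂ : Pred (Fin n) 0ℓ
      Q₂ y = (P y × ¬ y ≡ x) × ¬ y ≡ σ x

      Q₂? : Decidable Q₂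
      Q₂? = (P? ∩? ∁? (_≟ x)) ∩? ∁? (_≟ σ x)

      private
        preimage : ∀ {y z} → P y → σ y ≡ z → y ≡ σ z
        preimage py σy≡z = trans (sym (square≡id py)) (cong σ σy≡z)

      Q₂-closed : ∀ {y} → Q₂ y → Q₂ (σ y)
      Q₂-closed ((py , y≢x) , y≢σx) = (closed py , λ e → y≢σx (preimage py e)) ,
        λ e → y≢x (trans (preimage py e) (square≡id px))

      count-Q₂ : count P? ≡ 2 + count Q₂?
      count-Q₂ = trans (count-remove P? px) (cong suc (count-remove (P? ∩? ∁? (_≟ x)) (closed px , σx≢x)))

      count-fixed-Q₂ : count (P? ∩? Fixed? σ) ≡ count (Q₂? ∩? Fixed? σ)
      count-fixed-Q₂ = count-cong _ _
        ((λ (py , f) → ((py , λ { refl → σx≢x f }) , λ { refl → σx≢x (sym (trans (sym (square≡id px)) f)) }) , f) ,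
         λ (((py , _) , _) , f) → py , f)

    module FixedPoint {P : Pred (Fin n) 0ℓ} (P? : Decidable P) (σ : Fin n → Fin n) (closed : ∀ {x} → P x → P (σ x))
                      (injective : ∀ {x y} → P x → P y → σ x ≡ σ y → x ≡ y) {x : Fin n} (px : P x) (σx≡x : σ x ≡ x) where

      Q₁? : Decidable (λ y → P y × ¬ y ≡ x)
      Q₁? = P? ∩? ∁? (_≟ x)

      Q₁-closed : ∀ {y} → P y × ¬ y ≡ x → P (σ y) × ¬ σ y ≡ x
      Q₁-closed (py , y≢x) = closed py , λ σy≡x → y≢x (injective py px (trans σy≡x (sym σx≡x)))

      count-fixed-Q₁ : count (P? ∩? Fixed? σ) ≡ suc (count (Q₁? ∩? Fixed? σ))
      count-fixed-Q₁ = trans (count-remove (P? ∩? Fixed? σ) (px , σx≡x))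
        (cong suc (count-cong _ _ ((λ ((py , f) , y≢x) → (py , y≢x) , f) , λ ((py , y≢x) , f) → (py , f) , y≢x)))

    count-order3-fuel : ∀ N {P : Pred (Fin n) 0ℓ} (P? : Decidable P) (σ : Fin n → Fin n) →
      (∀ {x} → P x → P (σ x)) → (∀ {x} → P x → σ (σ (σ x)) ≡ x) → count P? ≤ N →
      ∃ λ k → count P? ≡ count (P? ∩? Fixed? σ) + 3 * k
    count-order3-fuel N P? σ closed cube≡id bound with any? P?
    ... | no ∄x = 0 , trans (count-none P? (λ x px → ∄x (x , px)))
                     (sym (trans (ℕ.+-identityʳ _) (count-none (P? ∩? Fixed? σ) (λ x (px , _) → ∄x (x , px)))))
    count-order3-fuel zero P? σ closed cube≡id bound | yes (x , px) =
      ⊥-elim (ℕ.<-irrefl refl (ℕ.≤-trans (ℕ.≤-trans (s≤s z≤n) (ℕ.≤-reflexive (sym (count-remove P? px)))) bound))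
    count-order3-fuel (suc N) {P} P? σ closed cube≡id bound | yes (x , px) with σ x ≟ x
    ... | yes σx≡x =
      let k , eq = count-order3-fuel N Q₁? σ Q₁-closed (λ (py , _) → cube≡id py)
                     (ℕ.≤-pred (ℕ.≤-trans (ℕ.≤-reflexive (sym (count-remove P? px))) bound))
      in k , trans (count-remove P? px) (trans (cong suc eq) (cong (_+ 3 * k) (sym count-fixed-Q₁)))
      where
        injective : ∀ {y z} → P y → P z → σ y ≡ σ z → y ≡ z
        injective py pz σy≡σz = trans (sym (cube≡id py)) (trans (cong (λ w → σ (σ w)) σy≡σz) (cube≡id pz))
        open FixedPoint P? σ closed injective px σx≡x
    ... | no σx≢x =
      let k , eq = count-order3-fuel N Q₃? σ Q₃-closed (λ (((py , _) , _) , _) → cube≡id py)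
                     (ℕ.≤-pred (ℕ.≤-pred (ℕ.≤-pred (ℕ.≤-trans (ℕ.≤-reflexive (sym count-Q₃)) bound′))))
      in suc k , trans count-Q₃ (trans (cong (λ m → 3 + m) eq)
                   (trans (x∙yz≈y∙xz 3 _ _) (cong₂ _+_ (sym count-fixed-Q₃) (sym (ℕ.*-suc 3 k)))))
      where
        open ThreeCycle P? σ closed cube≡id px σx≢x
        bound′ = ℕ.≤-trans bound (ℕ.≤-trans (ℕ.n≤1+n _) (ℕ.n≤1+n _))

    count-involution-fuel : ∀ N {P : Pred (Fin n) 0ℓ} (P? : Decidable P) (σ : Fin n → Fin n) →
      (∀ {x} → P x → P (σ x)) → (∀ {x} → P x → σ (σ x) ≡ x) → count P? ≤ N →
      ∃ λ k → count P? ≡ count (P? ∩? Fixed? σ) + 2 * k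
    count-involution-fuel N P? σ closed square≡id bound with any? P?
    ... | no ∄x = 0 , trans (count-none P? (λ x px → ∄x (x , px)))
                     (sym (trans (ℕ.+-identityʳ _) (count-none (P? ∩? Fixed? σ) (λ x (px , _) → ∄x (x , px)))))
    count-involution-fuel zero P? σ closed square≡id bound | yes (x , px) =
      ⊥-elim (ℕ.<-irrefl refl (ℕ.≤-trans (ℕ.≤-trans (s≤s z≤n) (ℕ.≤-reflexive (sym (count-remove P? px)))) bound))
    count-involution-fuel (suc N) {P} P? σ closed square≡id bound | yes (x , px) with σ x ≟ x
    ... | yes σx≡x =
      let k , eq = count-involution-fuel N Q₁? σ Q₁-closed (λ (py , _) → square≡id py)
                     (ℕ.≤-pred (ℕ.≤-trans (ℕ.≤-reflexive (sym (count-remove P? px))) bound))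
      in k , trans (count-remove P? px) (trans (cong suc eq) (cong (_+ 2 * k) (sym count-fixed-Q₁)))
      where
        injective : ∀ {y z} → P y → P z → σ y ≡ σ z → y ≡ z
        injective py pz σy≡σz = trans (sym (square≡id py)) (trans (cong σ σy≡σz) (square≡id pz))
        open FixedPoint P? σ closed injective px σx≡x
    ... | no σx≢x =
      let k , eq = count-involution-fuel N Q₂? σ Q₂-closed (λ ((py , _) , _) → square≡id py)
                     (ℕ.≤-pred (ℕ.≤-pred (ℕ.≤-trans (ℕ.≤-reflexive (sym count-Q₂)) bound′)))
      in suc k , trans count-Q₂ (trans (cong (λ m → 2 + m) eq)
                   (trans (x∙yz≈y∙xz 2 _ _) (cong₂ _+_ (sym count-fixed-Q₂) (sym (ℕ.*-suc 2 k)))))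
      where
        open TwoCycle P? σ closed square≡id px σx≢x
        bound′ = ℕ.≤-trans bound (ℕ.n≤1+n _)

  count-order3 : {P : Pred (Fin n) 0ℓ} (P? : Decidable P) (σ : Fin n → Fin n) →
    (∀ {x} → P x → P (σ x)) → (∀ {x} → P x → σ (σ (σ x)) ≡ x) →
    ∃ λ k → count P? ≡ count (P? ∩? Fixed? σ) + 3 * k
  count-order3 P? σ closed cube≡id = count-order3-fuel (count P?) P? σ closed cube≡id ℕ.≤-refl

  count-involution : {P : Pred (Fin n) 0ℓ} (P? : Decidable P) (σ : Fin n → Fin n) →
    (∀ {x} → P x → P (σ x)) → (∀ {x} → P x → σ (σ x) ≡ x) →
    ∃ λ k → count P? ≡ count (P? ∩? Fixed? σ) + 2 * k
  count-involution P? σ closed square≡id = count-involution-fuel (count P?) P? σ closed square≡id ℕ.≤-refl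

  count-two-witnesses : {P : Pred (Fin n) 0ℓ} (P? : Decidable P) → 2 ≤ count P? →
    ∃ λ x → ∃ λ y → P x × P y × ¬ x ≡ y
  count-two-witnesses P? 2≤count =
    let x , px = count-witness P? (ℕ.≤-trans (s≤s z≤n) 2≤count)
        y , (py , y≢x) = count-witness (P? ∩? ∁? (_≟ x)) (ℕ.≤-pred (ℕ.≤-trans 2≤count (ℕ.≤-reflexive (count-remove P? px))))
    in x , y , px , py , λ x≡y → y≢x (sym x≡y)

f+3k+2≡1-mod-3⇒2≤f : ∀ f k {n} → f + 3 * k + 2 ≡ n → n % 3 ≡ 1 → 2 ≤ f
f+3k+2≡1-mod-3⇒2≤f f k refl n%3≡1 = small-residue f (trans (sym ([m+kn]%n≡m%n (f + 2) k 3)) (trans (cong (_% 3) rearrange) n%3≡1))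
  where
    rearrange : f + 2 + k * 3 ≡ f + 3 * k + 2
    rearrange = trans (ℕ.+-assoc f 2 (k * 3)) (trans (cong (λ m → f + m) (trans (ℕ.+-comm 2 (k * 3)) (cong (_+ 2) (ℕ.*-comm k 3))))
      (sym (ℕ.+-assoc f (3 * k) 2)))
    small-residue : ∀ f → (f + 2) % 3 ≡ 1 → 2 ≤ f
    small-residue (suc (suc _)) _ = s≤s (s≤s z≤n)

f+2k≡0-mod-2⇒2≤f : ∀ f k {n} → 1 ≤ f → f + 2 * k ≡ n → n % 2 ≡ 0 → 2 ≤ f
f+2k≡0-mod-2⇒2≤f f k 1≤f refl n%2≡0 =
  small-residue f 1≤f (trans (sym ([m+kn]%n≡m%n f k 2)) (trans (cong (λ m → (f + m) % 2) (ℕ.*-comm k 2)) n%2≡0))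
  where
    small-residue : ∀ f → 1 ≤ f → f % 2 ≡ 0 → 2 ≤ f
    small-residue (suc (suc _)) _ _ = s≤s (s≤s z≤n)

module _ {q : ℕ} (𝔽 : FiniteField q) where
  open FiniteField 𝔽

  commutativeRing : CommutativeRing 0ℓ 0ℓ
  commutativeRing = record { isCommutativeRing = isCommutativeRing }

  open SemiringExp (CommutativeRing.semiring commutativeRing) public using (_^_)

  private
    open SemiringExp (CommutativeRing.semiring commutativeRing) using (^-homo-*; ^-assocʳ)
    open CommutativeRing commutativeRing
      using ( +-abelianGroup; +-commutativeSemigroup; ring; semiring; +-comm; +-identityˡ; +-identityʳ; -‿inverseʳ
            ; *-identityˡ; *-identityʳ; *-assoc; *-comm)
    open AbelianGroupProperties +-abelianGroup using (⁻¹-∙-comm; ε⁻¹≈ε; ⁻¹-involutive; ⁻¹-injective)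
    open CommutativeSemigroupProperties +-commutativeSemigroup using (interchange)
    open RingProperties ring using (-‿distribˡ-*; -‿distribʳ-*)
    open SemiringMult semiring using (×-homo-+; ×1-homo-*) renaming (_×_ to _·1_)

    -- The solver needs decidable equality of constants, hence integer coefficients; with the
    -- TCOptimised multiplication the constant 1 denotes 1F itself.
    ⟦_⟧ℕ : ℕ → Fin q
    ⟦ n ⟧ℕ = n ·1 1F

    ⟦_⟧ : ℤ → Fin q
    ⟦ + n ⟧ = ⟦ n ⟧ℕ
    ⟦ -[1+ n ] ⟧ = -F ⟦ suc n ⟧ℕ

    signed : Sign → Fin q → Fin q
    signed Sign.+ x = x
    signed Sign.- x = -F x

    ⟦◃⟧ : ∀ s n → ⟦ s ◃ n ⟧ ≡ signed s ⟦ n ⟧ℕ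
    ⟦◃⟧ Sign.+ zero = refl
    ⟦◃⟧ Sign.- zero = sym ε⁻¹≈ε
    ⟦◃⟧ Sign.+ (suc n) = refl
    ⟦◃⟧ Sign.- (suc n) = refl

    ⟦⟧-signed : ∀ i → ⟦ i ⟧ ≡ signed (sign i) ⟦ ∣ i ∣ ⟧ℕ
    ⟦⟧-signed (+ n) = refl
    ⟦⟧-signed -[1+ n ] = refl

    signed-* : ∀ s t x y → signed (s Sign.* t) (x *F y) ≡ signed s x *F signed t y
    signed-* Sign.+ Sign.+ x y = refl
    signed-* Sign.+ Sign.- x y = -‿distribʳ-* x y
    signed-* Sign.- Sign.+ x y = -‿distribˡ-* x y
    signed-* Sign.- Sign.- x y = sym (trans (sym (-‿distribˡ-* x (-F y)))
      (trans (cong -F_ (sym (-‿distribʳ-* x y))) (⁻¹-involutive _)))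

    ⟦⊖⟧ : ∀ m n → ⟦ m ⊖ n ⟧ ≡ ⟦ m ⟧ℕ +F -F ⟦ n ⟧ℕ
    ⟦⊖⟧ zero zero = sym (trans (cong (0F +F_) ε⁻¹≈ε) (+-identityˡ _))
    ⟦⊖⟧ zero (suc n) = sym (+-identityˡ _)
    ⟦⊖⟧ (suc m) zero = sym (trans (cong (⟦ suc m ⟧ℕ +F_) ε⁻¹≈ε) (+-identityʳ _))
    ⟦⊖⟧ (suc m) (suc n) = trans (cong ⟦_⟧ (ℤ.[1+m]⊖[1+n]≡m⊖n m n)) (trans (⟦⊖⟧ m n)
      (sym (trans (cong₂ (λ a b → a +F -F b) (×-homo-+ 1F 1 m) (×-homo-+ 1F 1 n)) (cancel-1 _ _))))
      where
        cancel-1 : ∀ a b → (1F +F a) +F -F (1F +F b) ≡ a +F -F b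
        cancel-1 a b = trans (cong ((1F +F a) +F_) (sym (⁻¹-∙-comm 1F b)))
          (trans (interchange 1F a (-F 1F) (-F b)) (trans (cong (_+F (a +F -F b)) (-‿inverseʳ 1F)) (+-identityˡ _)))

    ⟦⟧-+ : ∀ i j → ⟦ i ℤ.+ j ⟧ ≡ ⟦ i ⟧ +F ⟦ j ⟧
    ⟦⟧-+ (+ m) (+ n) = ×-homo-+ 1F m n
    ⟦⟧-+ (+ m) -[1+ n ] = ⟦⊖⟧ m (suc n)
    ⟦⟧-+ -[1+ m ] (+ n) = trans (⟦⊖⟧ n (suc m)) (+-comm _ _)
    ⟦⟧-+ -[1+ m ] -[1+ n ] = trans (cong -F_ (trans (cong ⟦_⟧ℕ (sym (ℕ.+-suc (suc m) n))) (×-homo-+ 1F (suc m) (suc n))))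
      (sym (⁻¹-∙-comm _ _))

    ⟦⟧-* : ∀ i j → ⟦ i ℤ.* j ⟧ ≡ ⟦ i ⟧ *F ⟦ j ⟧
    ⟦⟧-* i j = trans (⟦◃⟧ (sign i Sign.* sign j) (∣ i ∣ * ∣ j ∣))
      (trans (cong (signed (sign i Sign.* sign j)) (×1-homo-* ∣ i ∣ ∣ j ∣))
        (trans (signed-* (sign i) (sign j) _ _) (sym (cong₂ _*F_ (⟦⟧-signed i) (⟦⟧-signed j)))))

    ⟦⟧-neg : ∀ i → ⟦ ℤ.- i ⟧ ≡ -F ⟦ i ⟧
    ⟦⟧-neg (+ zero) = sym ε⁻¹≈ε
    ⟦⟧-neg (+ suc n) = refl
    ⟦⟧-neg -[1+ n ] = sym (⁻¹-involutive _)

    integers⟶𝔽 : CommutativeRing.rawRing ℤ.+-*-commutativeRing -Raw-AlmostCommutative⟶ fromCommutativeRing commutativeRing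
    integers⟶𝔽 = record { ⟦_⟧ = ⟦_⟧ ; +-homo = ⟦⟧-+ ; *-homo = ⟦⟧-* ; -‿homo = ⟦⟧-neg ; 0-homo = refl ; 1-homo = refl }

    ⟦⟧-≟ : ∀ i j → Maybe (⟦ i ⟧ ≡ ⟦ j ⟧)
    ⟦⟧-≟ i j with i ℤ.≟ j
    ... | yes refl = just refl
    ... | no _ = nothing

  open RingSolver (CommutativeRing.rawRing ℤ.+-*-commutativeRing) (fromCommutativeRing commutativeRing) integers⟶𝔽 ⟦⟧-≟ public

  infixl 6 _−_
  _−_ : Fin q → Fin q → Fin q
  x − y = x +F -F y

  −≡0⇒≡ : ∀ {x y} → x − y ≡ 0F → x ≡ y
  −≡0⇒≡ {x} {y} h = trans (solve 2 (λ x y → x := (x :- y) :+ y) refl x y)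
                      (trans (cong (_+F y) h) (solve 1 (λ y → con (+ 0) :+ y := y) refl y))

  ≡⇒−≡0 : ∀ {x y} → x ≡ y → x − y ≡ 0F
  ≡⇒−≡0 {x} refl = solve 1 (λ x → x :- x := con (+ 0)) refl x

  -- a = b follows from equalities c = d once a − b is exhibited as a combination of the c − d,
  -- a polynomial identity left to the solver.
  ≡-by-combination₁ : ∀ {a b c d} k → c ≡ d → a − b ≡ k *F (c − d) → a ≡ b
  ≡-by-combination₁ k c≡d h = −≡0⇒≡ (trans h (trans (cong (k *F_) (≡⇒−≡0 c≡d))
    (solve 1 (λ k → k :* con (+ 0) := con (+ 0)) refl k)))

  ≡-by-combination₂ : ∀ {a b c d c′ d′} k k′ → c ≡ d → c′ ≡ d′ →
    a − b ≡ k *F (c − d) +F k′ *F (c′ − d′) → a ≡ b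
  ≡-by-combination₂ k k′ c≡d c′≡d′ h = −≡0⇒≡ (trans h
    (trans (cong₂ (λ x y → k *F x +F k′ *F y) (≡⇒−≡0 c≡d) (≡⇒−≡0 c′≡d′))
      (solve 2 (λ k k′ → k :* con (+ 0) :+ k′ :* con (+ 0) := con (+ 0)) refl k k′)))

  infix 8 _⁻¹
  _⁻¹ : Fin q → Fin q
  x ⁻¹ with x ≟ 0F
  ... | yes _ = 0F
  ... | no x≢0 = proj₁ (inverse x x≢0)

  x*x⁻¹≡1 : ∀ {x} → x ≢ 0F → x *F x ⁻¹ ≡ 1F
  x*x⁻¹≡1 {x} x≢0 with x ≟ 0F
  ... | yes x≡0 = ⊥-elim (x≢0 x≡0)
  ... | no x≢0 = proj₂ (inverse x x≢0)

  zero-product : ∀ x y → x *F y ≡ 0F → x ≡ 0F ⊎ y ≡ 0F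
  zero-product x y xy≡0 with x ≟ 0F
  ... | yes x≡0 = inj₁ x≡0
  ... | no x≢0 = inj₂ (≡-by-combination₂ (x ⁻¹) (-F y) xy≡0 (x*x⁻¹≡1 x≢0)
          (solve 3 (λ x y x⁻¹ → y :- con (+ 0) := x⁻¹ :* (x :* y :- con (+ 0)) :+ (:- y) :* (x :* x⁻¹ :- con (+ 1)))
            refl x y (x ⁻¹)))

  *-nonzero : ∀ {x y} → x ≢ 0F → y ≢ 0F → x *F y ≢ 0F
  *-nonzero x≢0 y≢0 xy≡0 with zero-product _ _ xy≡0
  ... | inj₁ x≡0 = x≢0 x≡0
  ... | inj₂ y≡0 = y≢0 y≡0

  *-cancelˡ : ∀ {x y z} → x ≢ 0F → x *F y ≡ x *F z → y ≡ z
  *-cancelˡ {x} {y} {z} x≢0 xy≡xz with zero-product x (y − z)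
    (trans (solve 3 (λ x y z → x :* (y :- z) := x :* y :- x :* z) refl x y z) (≡⇒−≡0 xy≡xz))
  ... | inj₁ x≡0 = ⊥-elim (x≢0 x≡0)
  ... | inj₂ y−z≡0 = −≡0⇒≡ y−z≡0

  ⁻¹-unique : ∀ {x y} → x *F y ≡ 1F → x ⁻¹ ≡ y
  ⁻¹-unique {x} {y} xy≡1 = *-cancelˡ x≢0 (trans (x*x⁻¹≡1 x≢0) (sym xy≡1))
    where
      x≢0 : x ≢ 0F
      x≢0 x≡0 = 0≢1 (trans (sym (solve 1 (λ y → con (+ 0) :* y := con (+ 0)) refl y)) (trans (cong (_*F y) (sym x≡0)) xy≡1))

  ⁻¹-nonzero : ∀ {x} → x ≢ 0F → x ⁻¹ ≢ 0F
  ⁻¹-nonzero {x} x≢0 x⁻¹≡0 = 0≢1 (trans (sym (solve 1 (λ x → x :* con (+ 0) := con (+ 0)) refl x))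
    (trans (cong (x *F_) (sym x⁻¹≡0)) (x*x⁻¹≡1 x≢0)))

  ^-nonzero : ∀ {x} n → x ≢ 0F → x ^ n ≢ 0F
  ^-nonzero zero x≢0 1≡0 = 0≢1 (sym 1≡0)
  ^-nonzero (suc n) x≢0 = *-nonzero x≢0 (^-nonzero n x≢0)

  1^n≡1 : ∀ n → 1F ^ n ≡ 1F
  1^n≡1 zero = refl
  1^n≡1 (suc n) = trans (cong (1F *F_) (1^n≡1 n)) (solve 0 (con (+ 1) :* con (+ 1) := con (+ 1)) refl)

  ^-+-period : ∀ {x} k m → x ^ k ≡ 1F → x ^ (m + k) ≡ x ^ m
  ^-+-period {x} k m x^k≡1 = trans (^-homo-* x m k)
    (trans (cong (x ^ m *F_) x^k≡1) (solve 1 (λ y → y :* con (+ 1) := y) refl (x ^ m)))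

  ^-%-period : ∀ {x} k m .{{_ : ℕ.NonZero k}} → x ^ k ≡ 1F → x ^ m ≡ x ^ (m % k)
  ^-%-period {x} k m x^k≡1 = begin
    x ^ m                               ≡⟨ cong (x ^_) (m≡m%n+[m/n]*n m k) ⟩
    x ^ (m % k + (m / k) * k)       ≡⟨ ^-homo-* x (m % k) _ ⟩
    x ^ (m % k) *F x ^ ((m / k) * k)  ≡⟨ cong (λ e → x ^ (m % k) *F x ^ e) (ℕ.*-comm (m / k) k) ⟩
    x ^ (m % k) *F x ^ (k * (m / k))  ≡⟨ cong (x ^ (m % k) *F_) (sym (^-assocʳ x k (m / k))) ⟩
    x ^ (m % k) *F (x ^ k) ^ (m / k)    ≡⟨ cong (λ y → x ^ (m % k) *F y ^ (m / k)) x^k≡1 ⟩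
    x ^ (m % k) *F 1F ^ (m / k)         ≡⟨ cong (x ^ (m % k) *F_) (1^n≡1 (m / k)) ⟩
    x ^ (m % k) *F 1F                   ≡⟨ solve 1 (λ y → y :* con (+ 1) := y) refl (x ^ (m % k)) ⟩
    x ^ (m % k)                         ∎
    where open ≡-Reasoning

  ^-cancel : ∀ {x} i d → x ≢ 0F → x ^ i ≡ x ^ (i + d) → x ^ d ≡ 1F
  ^-cancel {x} i d x≢0 x^i≡x^[i+d] = sym (*-cancelˡ (^-nonzero i x≢0)
    (trans (solve 1 (λ y → y :* con (+ 1) := y) refl (x ^ i)) (trans x^i≡x^[i+d] (^-homo-* x i d))))

  order≥4 : q % 3 ≡ 1 → 4 ≤ q
  order≥4 q%3≡1 = by-quotient (q / 3) (trans (m≡m%n+[m/n]*n q 3) (cong (λ r → r + (q / 3) * 3) q%3≡1))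
    where
      toℕ≡0 : q ≡ 1 → ∀ (x : Fin q) → toℕ x ≡ 0
      toℕ≡0 q≡1 x = ℕ.n<1⇒n≡0 (subst (toℕ x <_) q≡1 (toℕ<n x))
      by-quotient : ∀ m → q ≡ 1 + m * 3 → 4 ≤ q
      by-quotient zero q≡1 = ⊥-elim (0≢1 (toℕ-injective (trans (toℕ≡0 q≡1 0F) (sym (toℕ≡0 q≡1 1F)))))
      by-quotient (suc m) q≡4+3m = subst (4 ≤_) (sym q≡4+3m) (s≤s (s≤s (s≤s (s≤s z≤n))))

  odd-order⇒2≢0 : q % 2 ≡ 1 → 1F +F 1F ≢ 0F
  odd-order⇒2≢0 q%2≡1 2≡0 = 0≢1′ (trans (sym q%2≡0) q%2≡1)
    where
      0≢1′ : 0 ≢ 1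
      0≢1′ ()
      τ : Fin q → Fin q
      τ x = x +F 1F
      τ²≡id : ∀ {x} → U x → τ (τ x) ≡ x
      τ²≡id {x} _ = ≡-by-combination₁ 1F 2≡0
        (solve 1 (λ x → x :+ con (+ 1) :+ con (+ 1) :- x := con (+ 1) :* (con (+ 1) :+ con (+ 1) :- con (+ 0))) refl x)
      no-fixed : ∀ x → ¬ (U x × τ x ≡ x)
      no-fixed x (_ , τx≡x) = 0≢1 (sym (≡-by-combination₁ 1F τx≡x
        (solve 1 (λ x → con (+ 1) :- con (+ 0) := con (+ 1) :* ((x :+ con (+ 1)) :- x)) refl x)))
      q≡2k : ∃ λ k → q ≡ k * 2
      q≡2k = let k , orbits = count-involution U? τ (λ _ → _) τ²≡id
             in k , trans (sym (count-all U? _)) (trans orbits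
                      (trans (cong (_+ 2 * k) (count-none (U? ∩? Fixed? τ) no-fixed)) (ℕ.*-comm 2 k)))
      q%2≡0 : q % 2 ≡ 0
      q%2≡0 = trans (cong (_% 2) (proj₂ q≡2k)) ([m+kn]%n≡m%n 0 (proj₁ q≡2k) 2)

  even-order⇒2≡0 : q % 2 ≡ 0 → 1F +F 1F ≡ 0F
  even-order⇒2≡0 q%2≡0 with count-two-witnesses (U? ∩? Fixed? τ) two-fixed
    where
      τ : Fin q → Fin q
      τ x = -F x
      two-fixed : 2 ≤ count (U? ∩? Fixed? τ)
      two-fixed =
        let k , orbits = count-involution U? τ (λ _ → _) (λ {x} _ → ⁻¹-involutive x)
        in f+2k≡0-mod-2⇒2≤f (count (U? ∩? Fixed? τ)) k
             (ℕ.≤-trans (s≤s z≤n) (ℕ.≤-reflexive (sym (count-remove (U? ∩? Fixed? τ) {0F} (_ , ε⁻¹≈ε)))))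
             (trans (sym orbits) (count-all {n = q} U? _)) q%2≡0
  ... | x , y , (_ , -x≡x) , (_ , -y≡y) , x≢y =
    [ id , (λ x−y≡0 → ⊥-elim (x≢y (−≡0⇒≡ x−y≡0))) ]′ (zero-product (1F +F 1F) (x − y)
      (≡-by-combination₂ (-F 1F) 1F -x≡x -y≡y
        (solve 2 (λ x y → (con (+ 1) :+ con (+ 1)) :* (x :- y) :- con (+ 0)
                          := (:- con (+ 1)) :* ((:- x) :- x) :+ con (+ 1) :* ((:- y) :- y)) refl x y)))

  -1≡1⇒2≡0 : -F 1F ≡ 1F → 1F +F 1F ≡ 0F
  -1≡1⇒2≡0 -1≡1 = ≡-by-combination₁ (-F 1F) -1≡1
    (solve 0 (con (+ 1) :+ con (+ 1) :- con (+ 0) := (:- con (+ 1)) :* (:- con (+ 1) :- con (+ 1))) refl)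

  2≡0⇒-1≡1 : 1F +F 1F ≡ 0F → -F 1F ≡ 1F
  2≡0⇒-1≡1 2≡0 = ≡-by-combination₁ (-F 1F) 2≡0
    (solve 0 (:- con (+ 1) :- con (+ 1) := (:- con (+ 1)) :* (con (+ 1) :+ con (+ 1) :- con (+ 0))) refl)

  Φ₃ : Fin q → Fin q
  Φ₃ w = w *F w +F w +F 1F

  conj : Fin q → Fin q
  conj w = -F 1F − w

  Φ₃-root-nonzero : ∀ {w} → Φ₃ w ≡ 0F → w ≢ 0F
  Φ₃-root-nonzero {w} Φ₃w≡0 w≡0 = 0≢1 (sym (≡-by-combination₂ 1F (-F (w +F 1F)) Φ₃w≡0 w≡0
    (solve 1 (λ w → con (+ 1) :- con (+ 0)
                    := con (+ 1) :* (w :* w :+ w :+ con (+ 1) :- con (+ 0)) :+ (:- (w :+ con (+ 1))) :* (w :- con (+ 0))) refl w)))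

  Φ₃-root-1+-nonzero : ∀ {w} → Φ₃ w ≡ 0F → 1F +F w ≢ 0F
  Φ₃-root-1+-nonzero {w} Φ₃w≡0 1+w≡0 = 0≢1 (sym (≡-by-combination₂ 1F (-F w) Φ₃w≡0 1+w≡0
    (solve 1 (λ w → con (+ 1) :- con (+ 0)
                    := con (+ 1) :* (w :* w :+ w :+ con (+ 1) :- con (+ 0)) :+ (:- w) :* (con (+ 1) :+ w :- con (+ 0))) refl w)))

  Φ₃-conj : ∀ {w} → Φ₃ w ≡ 0F → Φ₃ (conj w) ≡ 0F
  Φ₃-conj {w} Φ₃w≡0 = ≡-by-combination₁ 1F Φ₃w≡0
    (solve 1 (λ w → (:- con (+ 1) :- w) :* (:- con (+ 1) :- w) :+ (:- con (+ 1) :- w) :+ con (+ 1) :- con (+ 0)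
                    := con (+ 1) :* (w :* w :+ w :+ con (+ 1) :- con (+ 0))) refl w)

  Φ₃-roots : ∀ {ω w} → Φ₃ ω ≡ 0F → Φ₃ w ≡ 0F → w ≡ ω ⊎ w ≡ conj ω
  Φ₃-roots {ω} {w} Φ₃ω≡0 Φ₃w≡0 with zero-product (w − ω) (w − conj ω) (≡-by-combination₂ 1F (-F 1F) Φ₃w≡0 Φ₃ω≡0
    (solve 2 (λ w o → (w :- o) :* (w :- (:- con (+ 1) :- o)) :- con (+ 0)
                      := con (+ 1) :* (w :* w :+ w :+ con (+ 1) :- con (+ 0))
                         :+ (:- con (+ 1)) :* (o :* o :+ o :+ con (+ 1) :- con (+ 0))) refl w ω))
  ... | inj₁ w−ω≡0 = inj₁ (−≡0⇒≡ w−ω≡0)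
  ... | inj₂ w−ω̄≡0 = inj₂ (−≡0⇒≡ w−ω̄≡0)

  Φ₃-root≡1⇒conj≡self : ∀ {ω} → Φ₃ ω ≡ 0F → ω ≡ 1F → conj ω ≡ ω
  Φ₃-root≡1⇒conj≡self {ω} Φ₃ω≡0 ω≡1 = ≡-by-combination₂ (-F 1F) ω Φ₃ω≡0 ω≡1
    (solve 1 (λ w → (:- con (+ 1) :- w) :- w
                    := (:- con (+ 1)) :* (w :* w :+ w :+ con (+ 1) :- con (+ 0)) :+ w :* (w :- con (+ 1))) refl ω)

  conj-≢1 : ∀ {ω} → Φ₃ ω ≡ 0F → ω ≢ 1F → conj ω ≢ 1F
  conj-≢1 {ω} Φ₃ω≡0 ω≢1 ω̄≡1 = ω≢1 (≡-by-combination₂ (-F ω) (-F 1F) ω̄≡1 Φ₃ω≡0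
    (solve 1 (λ w → w :- con (+ 1)
                    := (:- w) :* ((:- con (+ 1) :- w) :- con (+ 1)) :+ (:- con (+ 1)) :* (w :* w :+ w :+ con (+ 1) :- con (+ 0))) refl ω))

  private
    NotZeroOrOne? : Decidable (λ x → x ≢ 0F × x ≢ 1F)
    NotZeroOrOne? = ∁? (_≟ 0F) ∩? ∁? (_≟ 1F)

    count-NotZeroOrOne : count NotZeroOrOne? + 2 ≡ q
    count-NotZeroOrOne = trans (ℕ.+-comm (count NotZeroOrOne?) 2) (sym (trans (sym (count-all U? _))
      (trans (count-remove U? {0F} _) (cong suc (trans (count-remove (U? ∩? ∁? (_≟ 0F)) {1F} (_ , λ 1≡0 → 0≢1 (sym 1≡0)))
        (cong suc (count-cong _ NotZeroOrOne? ((λ ((_ , x≢0) , x≢1) → x≢0 , x≢1) , λ (x≢0 , x≢1) → (_ , x≢0) , x≢1))))))))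

    1−x≢0 : ∀ {x} → x ≢ 1F → 1F − x ≢ 0F
    1−x≢0 x≢1 1−x≡0 = x≢1 (sym (−≡0⇒≡ 1−x≡0))

    -- σ has order 3 on the elements other than 0 and 1; at its fixed points (1 − x) x = 1, i.e. Φ₃ (−x) = 0.
    σ : Fin q → Fin q
    σ x = (1F − x) ⁻¹

    σ-closed : ∀ {x} → x ≢ 0F × x ≢ 1F → σ x ≢ 0F × σ x ≢ 1F
    σ-closed {x} (x≢0 , x≢1) = ⁻¹-nonzero (1−x≢0 x≢1) , λ σx≡1 → x≢0 (≡-by-combination₁ (-F 1F) (1−x≡1 σx≡1)
        (solve 1 (λ x → x :- con (+ 0) := (:- con (+ 1)) :* ((con (+ 1) :- x) :- con (+ 1))) refl x))
      where
        1−x≡1 : σ x ≡ 1F → 1F − x ≡ 1F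
        1−x≡1 σx≡1 = trans (solve 1 (λ x → con (+ 1) :- x := (con (+ 1) :- x) :* con (+ 1)) refl x)
          (trans (cong ((1F − x) *F_) (sym σx≡1)) (x*x⁻¹≡1 (1−x≢0 x≢1)))

    σ³≡id : ∀ {x} → x ≢ 0F × x ≢ 1F → σ (σ (σ x)) ≡ x
    σ³≡id {x} (x≢0 , x≢1) = trans (cong σ σ²x) (⁻¹-unique (≡-by-combination₁ (-F (x − 1F)) (x*x⁻¹≡1 x≢0)
        (solve 2 (λ x x⁻¹ → (con (+ 1) :- (x :- con (+ 1)) :* x⁻¹) :* x :- con (+ 1)
                           := (:- (x :- con (+ 1))) :* (x :* x⁻¹ :- con (+ 1))) refl x (x ⁻¹))))
      where
        σ²x : σ (σ x) ≡ (x − 1F) *F x ⁻¹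
        σ²x = ⁻¹-unique (≡-by-combination₂ 1F (x ⁻¹) (x*x⁻¹≡1 x≢0) (x*x⁻¹≡1 (1−x≢0 x≢1))
          (solve 3 (λ x s x⁻¹ → (con (+ 1) :- s) :* ((x :- con (+ 1)) :* x⁻¹) :- con (+ 1)
            := con (+ 1) :* (x :* x⁻¹ :- con (+ 1)) :+ x⁻¹ :* ((con (+ 1) :- x) :* s :- con (+ 1))) refl x (σ x) (x ⁻¹)))

    σ-fixed⇒Φ₃ : ∀ {x} → x ≢ 1F → σ x ≡ x → Φ₃ (-F x) ≡ 0F
    σ-fixed⇒Φ₃ {x} x≢1 σx≡x = ≡-by-combination₁ (-F 1F) (trans (cong ((1F − x) *F_) (sym σx≡x)) (x*x⁻¹≡1 (1−x≢0 x≢1)))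
      (solve 1 (λ x → (:- x) :* (:- x) :+ (:- x) :+ con (+ 1) :- con (+ 0)
                      := (:- con (+ 1)) :* ((con (+ 1) :- x) :* x :- con (+ 1))) refl x)

    two-σ-fixed-points : q % 3 ≡ 1 → 2 ≤ count (NotZeroOrOne? ∩? Fixed? σ)
    two-σ-fixed-points q%3≡1 =
      let k , orbits = count-order3 NotZeroOrOne? σ σ-closed σ³≡id
      in f+3k+2≡1-mod-3⇒2≤f (count (NotZeroOrOne? ∩? Fixed? σ)) k (trans (cong (_+ 2) (sym orbits)) count-NotZeroOrOne) q%3≡1

    distinct-σ-fixed-points⇒Φ₃-root : ∀ {x₁ x₂} → x₁ ≢ x₂ → x₁ ≢ 1F → x₂ ≢ 1F → σ x₁ ≡ x₁ → σ x₂ ≡ x₂ →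
      Σ (Fin q) λ ω → Φ₃ ω ≡ 0F × ω ≢ 1F
    distinct-σ-fixed-points⇒Φ₃-root {x₁} {x₂} x₁≢x₂ x₁≢1 x₂≢1 σx₁≡x₁ σx₂≡x₂ = -F x₁ , Φ₃-x₁ , -x₁≢1
      where
        Φ₃-x₁ : Φ₃ (-F x₁) ≡ 0F
        Φ₃-x₁ = σ-fixed⇒Φ₃ x₁≢1 σx₁≡x₁
        -x₁≢1 : -F x₁ ≢ 1F
        -x₁≢1 -x₁≡1 with Φ₃-roots Φ₃-x₁ (σ-fixed⇒Φ₃ x₂≢1 σx₂≡x₂)
        ... | inj₁ -x₂≡-x₁ = x₁≢x₂ (sym (⁻¹-injective -x₂≡-x₁))
        ... | inj₂ -x₂≡conj = x₁≢x₂ (sym (⁻¹-injective (trans -x₂≡conj (Φ₃-root≡1⇒conj≡self Φ₃-x₁ -x₁≡1))))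

  Φ₃-root-exists : q % 3 ≡ 1 → Σ (Fin q) λ ω → Φ₃ ω ≡ 0F × ω ≢ 1F
  Φ₃-root-exists q%3≡1 with count-two-witnesses (NotZeroOrOne? ∩? Fixed? σ) (two-σ-fixed-points q%3≡1)
  ... | _ , _ , ((_ , x₁≢1) , σx₁≡x₁) , ((_ , x₂≢1) , σx₂≡x₂) , x₁≢x₂ =
    distinct-σ-fixed-points⇒Φ₃-root x₁≢x₂ x₁≢1 x₂≢1 σx₁≡x₁ σx₂≡x₂

  module _ (F : Fin q) where
    open AGL 𝔽 F

    offset : Elt → Fin q
    offset u = apply u F − F

    -- affine a t is the map x ↦ a (x − F) + F + t.
    affine : Fin q → Fin q → Elt
    affine a t = a , t +F F − a *F F

    offset-affine : ∀ a t → offset (affine a t) ≡ t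
    offset-affine a t = solve 3 (λ a t F → a :* F :+ (t :+ F :- a :* F) :- F := t) refl a t F

    affine-offset : ∀ u → affine (proj₁ u) (offset u) ≡ u
    affine-offset (a , b) = cong (a ,_) (solve 3 (λ a b F → (a :* F :+ b :- F) :+ F :- a :* F := b) refl a b F)

    step : Fin q → Elt → Elt
    step w u = affine (w *F proj₁ u) ((1F +F w) *F offset u)

    preimage : Elt → Fin q
    preimage (a , b) = (F − b) *F a ⁻¹

    apply-preimage : ∀ u → IsAGL u → apply u (preimage u) ≡ F
    apply-preimage (a , b) a≢0 = ≡-by-combination₁ (F − b) (x*x⁻¹≡1 a≢0)
      (solve 4 (λ a b F a⁻¹ → a :* ((F :- b) :* a⁻¹) :+ b :- F := (F :- b) :* (a :* a⁻¹ :- con (+ 1))) refl a b F (a ⁻¹))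

    preimage-unique : ∀ u {x} → IsAGL u → apply u x ≡ F → x ≡ preimage u
    preimage-unique (a , b) {x} a≢0 ux≡F = *-cancelˡ a≢0 (≡-by-combination₂ 1F (-F 1F) ux≡F (apply-preimage (a , b) a≢0)
      (solve 5 (λ a b F x p → a :* x :- a :* p := con (+ 1) :* (a :* x :+ b :- F) :+ (:- con (+ 1)) :* (a :* p :+ b :- F))
        refl a b F x (preimage (a , b))))

    preimage≡F⇒offset≡0 : ∀ u → IsAGL u → preimage u ≡ F → offset u ≡ 0F
    preimage≡F⇒offset≡0 u a≢0 p≡F = ≡⇒−≡0 (subst (λ x → apply u x ≡ F) p≡F (apply-preimage u a≢0))

    crossing : Elt → Elt → Fin q
    crossing (a , b) (a′ , b′) = (b′ − b) *F (a − a′) ⁻¹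

    apply-crossing : ∀ u v → proj₁ u ≢ proj₁ v → apply u (crossing u v) ≡ apply v (crossing u v)
    apply-crossing (a , b) (a′ , b′) a≢a′ = ≡-by-combination₁ (b′ − b) (x*x⁻¹≡1 (λ a−a′≡0 → a≢a′ (−≡0⇒≡ a−a′≡0)))
      (solve 5 (λ a b a′ b′ d → a :* ((b′ :- b) :* d) :+ b :- (a′ :* ((b′ :- b) :* d) :+ b′)
                               := (b′ :- b) :* ((a :- a′) :* d :- con (+ 1))) refl a b a′ b′ ((a − a′) ⁻¹))

    crossing-unique : ∀ u v {x} → proj₁ u ≢ proj₁ v → apply u x ≡ apply v x → x ≡ crossing u v
    crossing-unique (a , b) (a′ , b′) {x} a≢a′ ux≡vx = *-cancelˡ (λ a−a′≡0 → a≢a′ (−≡0⇒≡ a−a′≡0))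
      (≡-by-combination₂ 1F (-F 1F) ux≡vx (apply-crossing (a , b) (a′ , b′) a≢a′)
        (solve 6 (λ a b a′ b′ x y → (a :- a′) :* x :- (a :- a′) :* y
                                   := con (+ 1) :* ((a :* x :+ b) :- (a′ :* x :+ b′)) :+ (:- con (+ 1)) :* ((a :* y :+ b) :- (a′ :* y :+ b′)))
          refl a b a′ b′ x (crossing (a , b) (a′ , b′))))

    same-slope-agree⇒≡ : ∀ u v {x} → proj₁ u ≡ proj₁ v → apply u x ≡ apply v x → u ≡ v
    same-slope-agree⇒≡ (a , b) (.a , b′) {x} refl ux≡vx = cong (a ,_) (≡-by-combination₁ 1F ux≡vx
      (solve 4 (λ a x b b′ → b :- b′ := con (+ 1) :* ((a :* x :+ b) :- (a :* x :+ b′))) refl a x b b′))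

    contract-F : ∀ π → contract π F ≡ F
    contract-F π with F ≟ F
    ... | yes _ = refl
    ... | no F≢F = ⊥-elim (F≢F refl)

    contract-preimage : ∀ π {x} → x ≢ F → π x ≡ F → contract π x ≡ π F
    contract-preimage π {x} x≢F πx≡F with x ≟ F
    ... | yes x≡F = ⊥-elim (x≢F x≡F)
    ... | no _ with π x ≟ F
    ...   | yes _ = refl
    ...   | no πx≢F = ⊥-elim (πx≢F πx≡F)

    contract-other : ∀ π {x} → x ≢ F → π x ≢ F → contract π x ≡ π x
    contract-other π {x} x≢F πx≢F with x ≟ F
    ... | yes x≡F = ⊥-elim (x≢F x≡F)
    ... | no _ with π x ≟ F
    ...   | yes πx≡F = ⊥-elim (πx≢F πx≡F)
    ...   | no _ = refl

    Agree? : ∀ u v → Decidable (λ x → contract (apply u) x ≡ contract (apply v) x)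
    Agree? u v x = contract (apply u) x ≟ contract (apply v) x

    agreements : Elt → Elt → ℕ
    agreements u v = count (Agree? u v)

    agreements+hd≡q : ∀ u v → agreements u v + hd (contract (apply u)) (contract (apply v)) ≡ q
    agreements+hd≡q u v = count-complement (Agree? u v)

    Adj⇔agreements≡4 : 4 ≤ q → ∀ {u v} → IsAGL u → IsAGL v → u ≢ v → Adj u v ⇔ agreements u v ≡ 4
    Adj⇔agreements≡4 4≤q {u} {v} a≢0 a′≢0 u≢v = mk⇔
      (λ (_ , _ , _ , H≡q−4) → begin
        A                ≡⟨ ℕ.m+n∸n≡m A H ⟨
        (A + H) ∸ H  ≡⟨ cong (_∸ H) (agreements+hd≡q u v) ⟩
        q ∸ H          ≡⟨ cong (q ∸_) H≡q−4 ⟩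
        q ∸ (q ∸ 4)  ≡⟨ ℕ.m∸[m∸n]≡n 4≤q ⟩
        4                ∎)
      (λ A≡4 → a≢0 , a′≢0 , u≢v , (begin
        H                ≡⟨ ℕ.m+n∸m≡n A H ⟨
        (A + H) ∸ A  ≡⟨ cong (_∸ A) (agreements+hd≡q u v) ⟩
        q ∸ A          ≡⟨ cong (q ∸_) A≡4 ⟩
        q ∸ 4          ∎))
      where
        open ≡-Reasoning
        A = agreements u v
        H = hd (contract (apply u)) (contract (apply v))

    candidates : Elt → Elt → List (Fin q)
    candidates u v = F ∷ preimage u ∷ preimage v ∷ crossing u v ∷ []

    -- Away from F and the preimages of F a contraction is the map itself, and distinct affine maps
    -- agree at most where they cross.
    agreements⊆candidates : ∀ {u v} → IsAGL u → IsAGL v → u ≢ v →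
      (λ x → contract (apply u) x ≡ contract (apply v) x) ⊆ (_∈ candidates u v)
    agreements⊆candidates {u} {v} a≢0 a′≢0 u≢v {x} agree = classify (x ≟ F) (x ≟ preimage u) (x ≟ preimage v)
      where
        classify : Dec (x ≡ F) → Dec (x ≡ preimage u) → Dec (x ≡ preimage v) → x ∈ candidates u v
        classify (yes x≡F) _ _ = here x≡F
        classify (no _) (yes x≡p) _ = there (here x≡p)
        classify (no _) (no _) (yes x≡p′) = there (there (here x≡p′))
        classify (no x≢F) (no x≢p) (no x≢p′) = there (there (there (here (crossing-unique u v a≢a′ ux≡vx))))
          where
            ux≡vx : apply u x ≡ apply v x
            ux≡vx = trans (sym (contract-other (apply u) x≢F (λ ux≡F → x≢p (preimage-unique u a≢0 ux≡F))))
              (trans agree (contract-other (apply v) x≢F (λ vx≡F → x≢p′ (preimage-unique v a′≢0 vx≡F))))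
            a≢a′ : proj₁ u ≢ proj₁ v
            a≢a′ a≡a′ = u≢v (same-slope-agree⇒≡ u v a≡a′ ux≡vx)

    Swaps : Elt → Elt → Set
    Swaps u v = apply u F ≡ apply v (preimage u) × apply u (preimage v) ≡ apply v F

    apply-injective : ∀ u {x y} → IsAGL u → apply u x ≡ apply u y → x ≡ y
    apply-injective (a , b) {x} {y} a≢0 ux≡uy = *-cancelˡ a≢0 (≡-by-combination₁ 1F ux≡uy
      (solve 4 (λ a b x y → a :* x :- a :* y := con (+ 1) :* ((a :* x :+ b) :- (a :* y :+ b))) refl a b x y))

    module _ {u v : Elt} (a≢0 : IsAGL u) (a′≢0 : IsAGL v) (offset-u≢0 : offset u ≢ 0F) (swaps : Swaps u v) where

      swaps-preimage≢ : preimage u ≢ preimage v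
      swaps-preimage≢ p≡p′ = offset-u≢0 (≡⇒−≡0 (trans (proj₁ swaps) (trans (cong (apply v) p≡p′) (apply-preimage v a′≢0))))

      swaps-offset≢0 : offset v ≢ 0F
      swaps-offset≢0 offset-v≡0 = swaps-preimage≢ (sym (preimage-unique u a≢0 (trans (proj₂ swaps) (−≡0⇒≡ offset-v≡0))))

      swaps-F≢ : apply u F ≢ apply v F
      swaps-F≢ uF≡vF = offset-u≢0 (≡⇒−≡0 (trans (cong (apply u) (sym p≡F)) (apply-preimage u a≢0)))
        where
          p≡F : preimage u ≡ F
          p≡F = apply-injective v a′≢0 (trans (sym (proj₁ swaps)) uF≡vF)

    swaps⇒Adj : 4 ≤ q → ∀ {u v} → IsAGL u → IsAGL v → proj₁ u ≢ proj₁ v → offset u ≢ 0F → Swaps u v → Adj u v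
    swaps⇒Adj 4≤q {u} {v} a≢0 a′≢0 a≢a′ offset-u≢0 swaps@(uF≡vp , up′≡vF) =
      Adj⇔agreements≡4 4≤q a≢0 a′≢0 u≢v .Equivalence.from
        (count≡length-cover⇐ (Agree? u v) (candidates u v) (agreements⊆candidates a≢0 a′≢0 u≢v)
          (agree-F ∷ agree-p ∷ agree-p′ ∷ agree-y ∷ [])
          ((≢-sym p≢F ∷ ≢-sym p′≢F ∷ ≢-sym y≢F ∷ []) ∷ (p≢p′ ∷ ≢-sym y≢p ∷ []) ∷ (≢-sym y≢p′ ∷ []) ∷ [] ∷ []))
      where
        p = preimage u
        p′ = preimage v
        y = crossing u v
        u≢v : u ≢ v
        u≢v u≡v = a≢a′ (cong proj₁ u≡v)
        p≢p′ = swaps-preimage≢ a≢0 a′≢0 offset-u≢0 swaps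
        p≢F : p ≢ F
        p≢F p≡F = offset-u≢0 (preimage≡F⇒offset≡0 u a≢0 p≡F)
        p′≢F : p′ ≢ F
        p′≢F p′≡F = swaps-offset≢0 a≢0 a′≢0 offset-u≢0 swaps (preimage≡F⇒offset≡0 v a′≢0 p′≡F)
        uy≡vy = apply-crossing u v a≢a′
        y≢F : y ≢ F
        y≢F y≡F = swaps-F≢ a≢0 a′≢0 offset-u≢0 swaps (subst (λ x → apply u x ≡ apply v x) y≡F uy≡vy)
        y≢p : y ≢ p
        y≢p y≡p = p≢p′ (preimage-unique v a′≢0 (trans (sym (subst (λ x → apply u x ≡ apply v x) y≡p uy≡vy)) (apply-preimage u a≢0)))
        y≢p′ : y ≢ p′
        y≢p′ y≡p′ = p≢p′ (sym (preimage-unique u a≢0 (trans (subst (λ x → apply u x ≡ apply v x) y≡p′ uy≡vy) (apply-preimage v a′≢0))))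
        agree-F = trans (contract-F _) (sym (contract-F _))
        agree-p = trans (contract-preimage (apply u) p≢F (apply-preimage u a≢0))
          (trans uF≡vp (sym (contract-other (apply v) p≢F (λ vp≡F → p≢p′ (preimage-unique v a′≢0 vp≡F)))))
        agree-p′ = trans (contract-other (apply u) p′≢F (λ up′≡F → p≢p′ (sym (preimage-unique u a≢0 up′≡F))))
          (trans up′≡vF (sym (contract-preimage (apply v) p′≢F (apply-preimage v a′≢0))))
        agree-y = trans (contract-other (apply u) y≢F (λ uy≡F → y≢p (preimage-unique u a≢0 uy≡F)))
          (trans uy≡vy (sym (contract-other (apply v) y≢F (λ vy≡F → y≢p′ (preimage-unique v a′≢0 vy≡F)))))

    Adj⇒swaps : 4 ≤ q → ∀ {u v} → Adj u v → offset u ≢ 0F × Swaps u v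
    Adj⇒swaps 4≤q {u} {v} adj@(a≢0 , a′≢0 , u≢v , _)
      with count≡length-cover⇒ (Agree? u v) (candidates u v) (agreements⊆candidates a≢0 a′≢0 u≢v)
             (Adj⇔agreements≡4 4≤q a≢0 a′≢0 u≢v .Equivalence.to adj)
    ... | (_ ∷ agree-p ∷ agree-p′ ∷ _) , ((F≢p ∷ F≢p′ ∷ _) ∷ (p≢p′ ∷ _) ∷ _) = offset-u≢0 ,
      trans (sym (contract-preimage (apply u) (≢-sym F≢p) (apply-preimage u a≢0)))
        (trans agree-p (contract-other (apply v) (≢-sym F≢p) (λ vp≡F → p≢p′ (preimage-unique v a′≢0 vp≡F)))) ,
      trans (sym (contract-other (apply u) (≢-sym F≢p′) (λ up′≡F → p≢p′ (sym (preimage-unique u a≢0 up′≡F)))))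
        (trans agree-p′ (contract-preimage (apply v) (≢-sym F≢p′) (apply-preimage v a′≢0)))
      where
        offset-u≢0 : offset u ≢ 0F
        offset-u≢0 offset-u≡0 = F≢p (preimage-unique u a≢0 (−≡0⇒≡ offset-u≡0))

    swaps⇒step : ∀ {u v} → IsAGL u → IsAGL v → Swaps u v → offset v ≢ 0F →
      let w = proj₁ v *F proj₁ u ⁻¹ in Φ₃ w ≡ 0F × v ≡ step w u
    swaps⇒step {a , b} {a′ , b′} a≢0 a′≢0 (uF≡vp , up′≡vF) offset-v≢0 = Φ₃w≡0 , v≡step
      where
        u = (a , b)
        v = (a′ , b′)
        p = preimage u
        p′ = preimage v
        w = a′ *F a ⁻¹
        t = offset u
        t′ = offset v
        first-swap : a *F t′ ≡ (a +F a′) *F t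
        first-swap = ≡-by-combination₂ (-F a) (-F a′) uF≡vp (apply-preimage u a≢0)
          (solve 6 (λ a b a′ b′ F p → a :* (a′ :* F :+ b′ :- F) :- (a :+ a′) :* (a :* F :+ b :- F)
                      := (:- a) :* ((a :* F :+ b) :- (a′ :* p :+ b′)) :+ (:- a′) :* ((a :* p :+ b) :- F)) refl a b a′ b′ F p)
        second-swap : a′ *F t ≡ (a′ +F a) *F t′
        second-swap = ≡-by-combination₂ (-F a′) (-F a) (sym up′≡vF) (apply-preimage v a′≢0)
          (solve 6 (λ a b a′ b′ F p′ → a′ :* (a :* F :+ b :- F) :- (a′ :+ a) :* (a′ :* F :+ b′ :- F)
                      := (:- a′) :* ((a′ :* F :+ b′) :- (a :* p′ :+ b)) :+ (:- a) :* ((a′ :* p′ :+ b′) :- F)) refl a b a′ b′ F p′)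
        aa′≡[a+a′]² : a *F a′ − (a +F a′) *F (a +F a′) ≡ 0F
        aa′≡[a+a′]² = [ id , (λ t′≡0 → ⊥-elim (offset-v≢0 t′≡0)) ]′ (zero-product _ _
          (≡-by-combination₂ a′ (a +F a′) first-swap second-swap
            (solve 4 (λ a a′ t t′ → (a :* a′ :- (a :+ a′) :* (a :+ a′)) :* t′ :- con (+ 0)
                        := a′ :* (a :* t′ :- (a :+ a′) :* t) :+ (a :+ a′) :* (a′ :* t :- (a′ :+ a) :* t′)) refl a a′ t t′)))
        Φ₃w≡0 : Φ₃ w ≡ 0F
        Φ₃w≡0 = ≡-by-combination₂ (-F (a ⁻¹ *F a ⁻¹)) (-F (a *F a ⁻¹ +F 1F +F w)) aa′≡[a+a′]² (x*x⁻¹≡1 a≢0)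
          (solve 3 (λ a a′ a⁻¹ → (a′ :* a⁻¹) :* (a′ :* a⁻¹) :+ a′ :* a⁻¹ :+ con (+ 1) :- con (+ 0)
                      := (:- (a⁻¹ :* a⁻¹)) :* ((a :* a′ :- (a :+ a′) :* (a :+ a′)) :- con (+ 0))
                         :+ (:- (a :* a⁻¹ :+ con (+ 1) :+ a′ :* a⁻¹)) :* (a :* a⁻¹ :- con (+ 1))) refl a a′ (a ⁻¹))
        v≡step : v ≡ step w u
        v≡step = cong₂ _,_
          (≡-by-combination₁ (-F a′) (x*x⁻¹≡1 a≢0)
            (solve 3 (λ a a′ a⁻¹ → a′ :- (a′ :* a⁻¹) :* a := (:- a′) :* (a :* a⁻¹ :- con (+ 1))) refl a a′ (a ⁻¹)))
          (≡-by-combination₂ (a ⁻¹) (a′ *F F − t′ +F t) first-swap (x*x⁻¹≡1 a≢0)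
            (solve 6 (λ a b a′ b′ F a⁻¹ → b′ :- ((con (+ 1) :+ a′ :* a⁻¹) :* (a :* F :+ b :- F) :+ F :- ((a′ :* a⁻¹) :* a) :* F)
               := a⁻¹ :* (a :* (a′ :* F :+ b′ :- F) :- (a :+ a′) :* (a :* F :+ b :- F))
                  :+ (a′ :* F :- (a′ :* F :+ b′ :- F) :+ (a :* F :+ b :- F)) :* (a :* a⁻¹ :- con (+ 1))) refl a b a′ b′ F (a ⁻¹)))

    step-IsAGL : ∀ {w u} → Φ₃ w ≡ 0F → IsAGL u → IsAGL (step w u)
    step-IsAGL Φ₃w≡0 a≢0 = *-nonzero (Φ₃-root-nonzero Φ₃w≡0) a≢0

    step-swaps : ∀ {w} u → Φ₃ w ≡ 0F → IsAGL u → Swaps u (step w u)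
    step-swaps {w} (a , b) Φ₃w≡0 a≢0 = uF≡vp , up′≡vF
      where
        u = (a , b)
        v = step w u
        p = preimage u
        p′ = preimage v
        uF≡vp : apply u F ≡ apply v p
        uF≡vp = ≡-by-combination₁ (-F w) (apply-preimage u a≢0)
          (solve 5 (λ a b F w p → (a :* F :+ b) :- ((w :* a) :* p :+ ((con (+ 1) :+ w) :* (a :* F :+ b :- F) :+ F :- (w :* a) :* F))
                                  := (:- w) :* (a :* p :+ b :- F)) refl a b F w p)
        up′≡vF : apply u p′ ≡ apply v F
        up′≡vF = ≡-by-combination₂ (w *F w) (-F ((w − 1F) *F a *F (p′ − F) +F w *F offset u))
          (apply-preimage v (step-IsAGL {w} {u} Φ₃w≡0 a≢0)) Φ₃w≡0
          (solve 5 (λ a b F w p′ → (a :* p′ :+ b) :- ((w :* a) :* F :+ ((con (+ 1) :+ w) :* (a :* F :+ b :- F) :+ F :- (w :* a) :* F))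
             := (w :* w) :* ((w :* a) :* p′ :+ ((con (+ 1) :+ w) :* (a :* F :+ b :- F) :+ F :- (w :* a) :* F) :- F)
                :+ (:- ((w :- con (+ 1)) :* a :* (p′ :- F) :+ w :* (a :* F :+ b :- F))) :* (w :* w :+ w :+ con (+ 1) :- con (+ 0)))
             refl a b F w p′)

    step-adjacent : 4 ≤ q → ∀ {w u} → IsAGL u → offset u ≢ 0F → Φ₃ w ≡ 0F → w ≢ 1F → Adj u (step w u)
    step-adjacent 4≤q {w} {u@(a , _)} a≢0 offset-u≢0 Φ₃w≡0 w≢1 =
      swaps⇒Adj 4≤q a≢0 (step-IsAGL {w} {u} Φ₃w≡0 a≢0) a≢wa offset-u≢0 (step-swaps u Φ₃w≡0 a≢0)
      where
        a≢wa : a ≢ w *F a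
        a≢wa a≡wa = w≢1 (*-cancelˡ a≢0 (trans (solve 2 (λ a w → a :* w := w :* a) refl a w)
          (trans (sym a≡wa) (solve 1 (λ a → a := a :* con (+ 1)) refl a))))

    Adj⇒step : 4 ≤ q → ∀ {u v} → Adj u v →
      let w = proj₁ v *F proj₁ u ⁻¹ in offset u ≢ 0F × Φ₃ w ≡ 0F × v ≡ step w u
    Adj⇒step 4≤q adj@(a≢0 , a′≢0 , _) =
      let offset-u≢0 , swaps = Adj⇒swaps 4≤q adj
      in offset-u≢0 , swaps⇒step a≢0 a′≢0 swaps (swaps-offset≢0 a≢0 a′≢0 offset-u≢0 swaps)

    step-affine : ∀ w a t → step w (affine a t) ≡ affine (w *F a) ((1F +F w) *F t)
    step-affine w a t = cong (λ t′ → affine (w *F a) ((1F +F w) *F t′)) (offset-affine a t)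

    step-conj-step : ∀ {w} u → Φ₃ w ≡ 0F → step (conj w) (step w u) ≡ u
    step-conj-step {w} u@(a , _) Φ₃w≡0 = begin
      step (conj w) (step w u)                                           ≡⟨ step-affine (conj w) _ _ ⟩
      affine (conj w *F (w *F a)) ((1F +F conj w) *F ((1F +F w) *F t))   ≡⟨ cong₂ affine slope offset′ ⟩
      affine a t                                                         ≡⟨ affine-offset u ⟩
      u                                                                  ∎
      where
        open ≡-Reasoning
        t = offset u
        slope = ≡-by-combination₁ (-F a) Φ₃w≡0
          (solve 2 (λ w a → (:- con (+ 1) :- w) :* (w :* a) :- a := (:- a) :* (w :* w :+ w :+ con (+ 1) :- con (+ 0))) refl w a)
        offset′ = ≡-by-combination₁ (-F t) Φ₃w≡0
          (solve 2 (λ w t → (con (+ 1) :+ (:- con (+ 1) :- w)) :* ((con (+ 1) :+ w) :* t) :- t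
                            := (:- t) :* (w :* w :+ w :+ con (+ 1) :- con (+ 0))) refl w t)

    module WithCubeRoot (4≤q : 4 ≤ q) {ω : Fin q} (Φ₃ω≡0 : Φ₃ ω ≡ 0F) (ω≢1 : ω ≢ 1F) where

      φ ψ : Elt → Elt
      φ = step ω
      ψ = step (conj ω)

      ψ∘φ≡id : ∀ u → ψ (φ u) ≡ u
      ψ∘φ≡id u = step-conj-step u Φ₃ω≡0

      φ∘ψ≡id : ∀ u → φ (ψ u) ≡ u
      φ∘ψ≡id u = subst (λ w → step w (ψ u) ≡ u) conj-conj (step-conj-step u (Φ₃-conj Φ₃ω≡0))
        where
          conj-conj : conj (conj ω) ≡ ω
          conj-conj = solve 1 (λ w → :- con (+ 1) :- (:- con (+ 1) :- w) := w) refl ω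

      φ-adjacent : ∀ {u} → IsAGL u → offset u ≢ 0F → Adj u (φ u)
      φ-adjacent a≢0 offset-u≢0 = step-adjacent 4≤q a≢0 offset-u≢0 Φ₃ω≡0 ω≢1

      ψ-adjacent : ∀ {u} → IsAGL u → offset u ≢ 0F → Adj u (ψ u)
      ψ-adjacent a≢0 offset-u≢0 = step-adjacent 4≤q a≢0 offset-u≢0 (Φ₃-conj Φ₃ω≡0) (conj-≢1 Φ₃ω≡0 ω≢1)

      neighbours : ∀ {u v} → Adj u v → v ≡ φ u ⊎ v ≡ ψ u
      neighbours {u} adj =
        let _ , Φ₃w≡0 , v≡step = Adj⇒step 4≤q adj
        in Sum.map (λ w≡ω → trans v≡step (cong (λ w → step w u) w≡ω))
                   (λ w≡ω̄ → trans v≡step (cong (λ w → step w u) w≡ω̄)) (Φ₃-roots Φ₃ω≡0 Φ₃w≡0)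

      isolated⇔offset≡0 : ∀ {u} → IsAGL u → Isolated u ⇔ offset u ≡ 0F
      isolated⇔offset≡0 {u} a≢0 = mk⇔
        (λ isolated → decidable-stable (offset u ≟ 0F) (λ offset-u≢0 → isolated (φ u) (φ-adjacent a≢0 offset-u≢0)))
        (λ offset-u≡0 v adj → proj₁ (Adj⇒step 4≤q adj) offset-u≡0)

      non-isolated⇒offset≢0 : ∀ {u} → IsAGL u → ¬ Isolated u → offset u ≢ 0F
      non-isolated⇒offset≢0 a≢0 ¬isolated offset-u≡0 = ¬isolated (isolated⇔offset≡0 a≢0 .Equivalence.from offset-u≡0)

      isolated⇔fixes-F : ∀ {u} → IsAGL u → Isolated u ⇔ apply u F ≡ F
      isolated⇔fixes-F a≢0 = mk⇔ (−≡0⇒≡ ∘ isolated⇔offset≡0 a≢0 .Equivalence.to)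
                                 (isolated⇔offset≡0 a≢0 .Equivalence.from ∘ ≡⇒−≡0)

      isolated-vertices : Σ (List Elt) λ L → Unique L × length L ≡ q ∸ 1
        × (∀ u → (u ∈ L → IsAGL u × Isolated u) × (IsAGL u × Isolated u → u ∈ L))
      isolated-vertices = L , unique , length-L , λ u → members⇒isolated , isolated⇒member
        where
          NonZero? = ∁? (_≟ 0F)
          fixing-F : Fin q → Elt
          fixing-F a = affine a 0F
          L = map fixing-F (filter NonZero? (allFin q))

          unique : Unique L
          unique = Unique.map⁺ (cong proj₁) (Unique.filter⁺ NonZero? (Unique.allFin⁺ q))

          length-L : length L ≡ q ∸ 1
          length-L = trans (length-map fixing-F (filter NonZero? (allFin q)))
            (cong (_∸ 1) (sym (trans (sym (count-all {n = q} U? _)) (trans (count-remove U? {0F} _)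
              (cong suc (count-cong _ NonZero? (proj₂ , (_ ,_))))))))

          members⇒isolated : ∀ {u} → u ∈ L → IsAGL u × Isolated u
          members⇒isolated u∈L with ∈-map⁻ fixing-F u∈L
          ... | a , a∈ , refl = a≢0 , isolated⇔offset≡0 a≢0 .Equivalence.from (offset-affine a 0F)
            where
              a≢0 = proj₂ (∈-filter⁻ NonZero? {xs = allFin q} a∈)

          isolated⇒member : ∀ {u} → IsAGL u × Isolated u → u ∈ L
          isolated⇒member {u} (a≢0 , isolated) = subst (_∈ L)
            (trans (cong (affine (proj₁ u)) (sym (isolated⇔offset≡0 a≢0 .Equivalence.to isolated))) (affine-offset u))
            (∈-map⁺ fixing-F (∈-filter⁺ NonZero? (∈-allFin (proj₁ u)) a≢0))

      μ : Fin q
      μ = 1F +F ω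

      module _ {u : Elt} (a≢0 : IsAGL u) (offset-u≢0 : offset u ≢ 0F) where

        orbit : ℕ → Elt
        orbit m = affine (ω ^ m *F proj₁ u) (μ ^ m *F offset u)

        orbit-zero : orbit 0 ≡ u
        orbit-zero = trans (cong₂ affine (*-identityˡ _) (*-identityˡ _)) (affine-offset u)

        φ-orbit : ∀ m → φ (orbit m) ≡ orbit (suc m)
        φ-orbit m = trans (step-affine ω _ _) (cong₂ affine (sym (*-assoc ω _ _)) (sym (*-assoc μ _ _)))

        orbit-IsAGL : ∀ m → IsAGL (orbit m)
        orbit-IsAGL m = *-nonzero (^-nonzero m (Φ₃-root-nonzero Φ₃ω≡0)) a≢0

        orbit-offset≢0 : ∀ m → offset (orbit m) ≢ 0F
        orbit-offset≢0 m offset≡0 = *-nonzero (^-nonzero m (Φ₃-root-1+-nonzero Φ₃ω≡0)) offset-u≢0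
          (trans (sym (offset-affine _ _)) offset≡0)

        reachable-orbit : ∀ m → Reachable u (orbit m)
        reachable-orbit zero = subst (Reachable u) (sym orbit-zero) ε
        reachable-orbit (suc m) = reachable-orbit m ◅◅
          (subst (Adj (orbit m)) (φ-orbit m) (φ-adjacent (orbit-IsAGL m) (orbit-offset≢0 m)) ◅ ε)

        module _ (n : ℕ) (ω^k≡1 : ω ^ suc n ≡ 1F) (μ^k≡1 : μ ^ suc n ≡ 1F) where

          orbit-+-period : ∀ m → orbit (m + suc n) ≡ orbit m
          orbit-+-period m = cong₂ affine (cong (_*F proj₁ u) (^-+-period (suc n) m ω^k≡1))
                                          (cong (_*F offset u) (^-+-period (suc n) m μ^k≡1))

          orbit-%-period : ∀ m → orbit m ≡ orbit (m % suc n)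
          orbit-%-period m = cong₂ affine (cong (_*F proj₁ u) (^-%-period (suc n) m ω^k≡1))
                                          (cong (_*F offset u) (^-%-period (suc n) m μ^k≡1))

          ψ-orbit : ∀ m → ψ (orbit m) ≡ orbit (m + n)
          ψ-orbit m = begin
            ψ (orbit m)                    ≡⟨ cong ψ (sym (orbit-+-period m)) ⟩
            ψ (orbit (m + suc n))        ≡⟨ cong (ψ ∘ orbit) (ℕ.+-suc m n) ⟩
            ψ (orbit (suc (m + n)))      ≡⟨ cong ψ (sym (φ-orbit (m + n))) ⟩
            ψ (φ (orbit (m + n)))        ≡⟨ ψ∘φ≡id _ ⟩
            orbit (m + n)                ∎
            where open ≡-Reasoning

          reachable⇒orbit : ∀ {x w} → Reachable x w → ∀ m → x ≡ orbit m → ∃ λ m′ → w ≡ orbit m′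
          reachable⇒orbit ε m x≡orbit-m = m , x≡orbit-m
          reachable⇒orbit {x} (adj ◅ rest) m refl =
            [ (λ y≡φ → reachable⇒orbit rest (suc m) (trans y≡φ (φ-orbit m))) ,
              (λ y≡ψ → reachable⇒orbit rest (m + n) (trans y≡ψ (ψ-orbit m))) ]′ (neighbours adj)

          module _ (minimal : ∀ d → 0 < d → d < suc n → ω ^ d ≢ 1F ⊎ μ ^ d ≢ 1F) where

            private
              equal-powers⇒≡ : ∀ {i j} → i ≤ j → j < suc n → ω ^ i ≡ ω ^ j → μ ^ i ≡ μ ^ j → i ≡ j
              equal-powers⇒≡ {i} {j} i≤j j<k ω^i≡ω^j μ^i≡μ^j =
                by-difference (j ∸ i) (ℕ.m+[n∸m]≡n i≤j) (ℕ.≤-<-trans (ℕ.m∸n≤m j i) j<k)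
                where
                  by-difference : ∀ d → i + d ≡ j → d < suc n → i ≡ j
                  by-difference zero i+0≡j _ = trans (sym (ℕ.+-identityʳ i)) i+0≡j
                  by-difference d@(suc _) i+d≡j d<k with minimal d (s≤s z≤n) d<k
                  ... | inj₁ ω^d≢1 = ⊥-elim (ω^d≢1 (^-cancel i d (Φ₃-root-nonzero Φ₃ω≡0)
                                      (trans ω^i≡ω^j (cong (ω ^_) (sym i+d≡j)))))
                  ... | inj₂ μ^d≢1 = ⊥-elim (μ^d≢1 (^-cancel i d (Φ₃-root-1+-nonzero Φ₃ω≡0)
                                      (trans μ^i≡μ^j (cong (μ ^_) (sym i+d≡j)))))

              *-cancelʳ : ∀ {x y z} → z ≢ 0F → x *F z ≡ y *F z → x ≡ y
              *-cancelʳ {x} {y} {z} z≢0 xz≡yz = *-cancelˡ z≢0 (trans (*-comm z x) (trans xz≡yz (*-comm y z)))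

            orbit-injective : ∀ {i j} → i < suc n → j < suc n → orbit i ≡ orbit j → i ≡ j
            orbit-injective {i} {j} i<k j<k orbit-i≡orbit-j =
              [ (λ i≤j → equal-powers⇒≡ i≤j j<k ω^i≡ω^j μ^i≡μ^j) ,
                (λ j≤i → sym (equal-powers⇒≡ j≤i i<k (sym ω^i≡ω^j) (sym μ^i≡μ^j))) ]′ (ℕ.≤-total i j)
              where
                ω^i≡ω^j = *-cancelʳ a≢0 (cong proj₁ orbit-i≡orbit-j)
                μ^i≡μ^j = *-cancelʳ offset-u≢0
                  (trans (sym (offset-affine _ _)) (trans (cong offset orbit-i≡orbit-j) (offset-affine _ _)))

            component-is-cycle : ComponentIsCycle n u
            component-is-cycle = vertex , (λ i → orbit-IsAGL (toℕ i)) , vertex-injective , membership ,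
              λ i j → adjacent⇒cyclic i j , cyclic⇒adjacent i j
              where
                vertex : Fin (suc n) → Elt
                vertex i = orbit (toℕ i)

                vertex-injective : ∀ i j → vertex i ≡ vertex j → i ≡ j
                vertex-injective i j vi≡vj = toℕ-injective (orbit-injective (toℕ<n i) (toℕ<n j) vi≡vj)

                orbit-suc : ∀ m → orbit (suc m % suc n) ≡ φ (orbit m)
                orbit-suc m = trans (sym (orbit-%-period (suc m))) (sym (φ-orbit m))

                membership : ∀ w → IsAGL w → (Reachable u w → ∃ λ i → w ≡ vertex i) × ((∃ λ i → w ≡ vertex i) → Reachable u w)
                membership w _ = from-reachable , λ (i , w≡vi) → subst (Reachable u) (sym w≡vi) (reachable-orbit (toℕ i))
                  where
                    from-reachable : Reachable u w → ∃ λ i → w ≡ vertex i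
                    from-reachable reach =
                      let m , w≡orbit-m = reachable⇒orbit reach 0 (sym orbit-zero)
                      in fromℕ< (m%n<n m (suc n)) ,
                         trans w≡orbit-m (trans (orbit-%-period m) (cong orbit (sym (toℕ-fromℕ< (m%n<n m (suc n))))))

                adjacent⇒cyclic : ∀ i j → Adj (vertex i) (vertex j) → CycAdj n i j
                adjacent⇒cyclic i j adj = [ φ-case , ψ-case ]′ (neighbours adj)
                  where
                    φ-case : vertex j ≡ φ (vertex i) → CycAdj n i j
                    φ-case vj≡φvi = inj₁ (orbit-injective (toℕ<n j) (m%n<n (suc (toℕ i)) (suc n))
                      (trans vj≡φvi (sym (orbit-suc (toℕ i)))))
                    ψ-case : vertex j ≡ ψ (vertex i) → CycAdj n i j
                    ψ-case vj≡ψvi = inj₂ (orbit-injective (toℕ<n i) (m%n<n (suc (toℕ j)) (suc n))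
                      (trans (sym (φ∘ψ≡id (vertex i))) (trans (cong φ (sym vj≡ψvi)) (sym (orbit-suc (toℕ j))))))

                cyclic⇒adjacent : ∀ i j → CycAdj n i j → Adj (vertex i) (vertex j)
                cyclic⇒adjacent i j (inj₁ j≡1+i) =
                  subst (Adj (vertex i)) (trans (sym (orbit-suc (toℕ i))) (cong orbit (sym j≡1+i)))
                    (φ-adjacent (orbit-IsAGL (toℕ i)) (orbit-offset≢0 (toℕ i)))
                cyclic⇒adjacent i j (inj₂ i≡1+j) =
                  subst (Adj (vertex i)) (trans (cong ψ (trans (cong orbit i≡1+j) (orbit-suc (toℕ j)))) (ψ∘φ≡id (vertex j)))
                    (ψ-adjacent (orbit-IsAGL (toℕ i)) (orbit-offset≢0 (toℕ i)))

      ω^1≢1 : ω ^ 1 ≢ 1F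
      ω^1≢1 ω^1≡1 = ω≢1 (trans (sym (*-identityʳ ω)) ω^1≡1)

      ω^2≢1 : ω ^ 2 ≢ 1F
      ω^2≢1 ω^2≡1 = conj-≢1 Φ₃ω≡0 ω≢1 (trans (sym ω^2≡conj) ω^2≡1)
        where
          ω^2≡conj : ω ^ 2 ≡ conj ω
          ω^2≡conj = ≡-by-combination₁ 1F Φ₃ω≡0
            (solve 1 (λ w → w :* (w :* con (+ 1)) :- (:- con (+ 1) :- w) := con (+ 1) :* (w :* w :+ w :+ con (+ 1) :- con (+ 0))) refl ω)

      ω^3≡1 : ω ^ 3 ≡ 1F
      ω^3≡1 = ≡-by-combination₁ (ω − 1F) Φ₃ω≡0
        (solve 1 (λ w → w :* (w :* (w :* con (+ 1))) :- con (+ 1) := (w :- con (+ 1)) :* (w :* w :+ w :+ con (+ 1) :- con (+ 0))) refl ω)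

      μ^3≡-1 : μ ^ 3 ≡ -F 1F
      μ^3≡-1 = ≡-by-combination₁ (1F +F 1F +F ω) Φ₃ω≡0
        (solve 1 (λ w → (con (+ 1) :+ w) :* ((con (+ 1) :+ w) :* ((con (+ 1) :+ w) :* con (+ 1))) :- (:- con (+ 1))
                        := (con (+ 1) :+ con (+ 1) :+ w) :* (w :* w :+ w :+ con (+ 1) :- con (+ 0))) refl ω)

      -- ω has order 3 and μ³ = −1, so the common order of ω and μ is 6 when −1 ≠ 1.
      component-is-hexagon : 1F +F 1F ≢ 0F → ∀ u → IsAGL u → ¬ Isolated u → ComponentIsCycle 5 u
      component-is-hexagon 2≢0 u a≢0 ¬isolated =
        component-is-cycle a≢0 (non-isolated⇒offset≢0 a≢0 ¬isolated) 5 ω^6≡1 μ^6≡1 minimal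
        where
          ω^6≡1 : ω ^ 6 ≡ 1F
          ω^6≡1 = trans (^-+-period 3 3 ω^3≡1) ω^3≡1
          μ^6≡1 : μ ^ 6 ≡ 1F
          μ^6≡1 = trans (^-homo-* μ 3 3) (trans (cong₂ _*F_ μ^3≡-1 μ^3≡-1)
            (solve 0 ((:- con (+ 1)) :* (:- con (+ 1)) := con (+ 1)) refl))
          minimal : ∀ d → 0 < d → d < 6 → ω ^ d ≢ 1F ⊎ μ ^ d ≢ 1F
          minimal 1 _ _ = inj₁ ω^1≢1
          minimal 2 _ _ = inj₁ ω^2≢1
          minimal 3 _ _ = inj₂ λ μ^3≡1 → 2≢0 (-1≡1⇒2≡0 (trans (sym μ^3≡-1) μ^3≡1))
          minimal 4 _ _ = inj₁ λ ω^4≡1 → ω^1≢1 (trans (sym (^-+-period 3 1 ω^3≡1)) ω^4≡1)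
          minimal 5 _ _ = inj₁ λ ω^5≡1 → ω^2≢1 (trans (sym (^-+-period 3 2 ω^3≡1)) ω^5≡1)
          minimal (suc (suc (suc (suc (suc (suc _)))))) _ (s≤s (s≤s (s≤s (s≤s (s≤s (s≤s ()))))))

      component-is-triangle : 1F +F 1F ≡ 0F → ∀ u → IsAGL u → ¬ Isolated u → ComponentIsCycle 2 u
      component-is-triangle 2≡0 u a≢0 ¬isolated =
        component-is-cycle a≢0 (non-isolated⇒offset≢0 a≢0 ¬isolated) 2 ω^3≡1 (trans μ^3≡-1 (2≡0⇒-1≡1 2≡0)) minimal
        where
          minimal : ∀ d → 0 < d → d < 3 → ω ^ d ≢ 1F ⊎ μ ^ d ≢ 1F
          minimal 1 _ _ = inj₁ ω^1≢1
          minimal 2 _ _ = inj₁ ω^2≢1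
          minimal (suc (suc (suc _))) _ (s≤s (s≤s (s≤s ())))

theorem6 : (q : ℕ) → IsPrimePower q → q % 3 ≡ 1 → (𝔽 : FiniteField q) → (F : Fin q) →
    let open AGL 𝔽 F in
      ((Σ (List Elt) λ L → Unique L × length L ≡ q ∸ 1
          × (∀ u → (u ∈ L → IsAGL u × Isolated u) × (IsAGL u × Isolated u → u ∈ L)))
       × (∀ u → IsAGL u → (Isolated u → apply u F ≡ F) × (apply u F ≡ F → Isolated u)))
      × (q % 2 ≡ 1 → ∀ u → IsAGL u → ¬ Isolated u → ComponentIsCycle 5 u)
      × (q % 2 ≡ 0 → ∀ u → IsAGL u → ¬ Isolated u → ComponentIsCycle 2 u)
theorem6 q _ q%3≡1 𝔽 F =
  (isolated-vertices , λ u a≢0 → isolated⇔fixes-F a≢0 .Equivalence.to , isolated⇔fixes-F a≢0 .Equivalence.from) ,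
  (λ q%2≡1 → component-is-hexagon (odd-order⇒2≢0 𝔽 q%2≡1)) ,
  (λ q%2≡0 → component-is-triangle (even-order⇒2≡0 𝔽 q%2≡0))
  where
    ω-root = Φ₃-root-exists 𝔽 q%3≡1
    open WithCubeRoot 𝔽 F (order≥4 𝔽 q%3≡1) (proj₁ (proj₂ ω-root)) (proj₂ (proj₂ ω-root))
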